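{- The linear map $\mathcal D_n\to\mathcal F_n$ defined by $$1_{n_1,\dots,n_k}=\sum_{|S|=n}1_{n_1,\dots,n_k}(S)\longmapsto 1_{n_1,\dots,n_k}([n])=O_{n_1,\dots,n_k}$$ (for all compositions $(n_1,\dots,n_k)$ of $n$) is an isomorphism of algebras from $(\mathcal D_n,\circ)$ onto $(\mathcal F_n,\circ)$.
   Context: Let $\mathbf k$ be a field, $\mathbf N$ the positive integers, $\mathcal P$ the set of finite subsets of $\mathbf N$, $[n]=\{1,\dots,n\}$. $\mathcal T$ is the $\mathbf k$-vector space with basis the symbols $1_{(S_1,\dots,S_k)}$, $k\ge0$, with $S_i\in\mathcal P$ nonempty and pairwise disjoint (a symbol with empty entries means the one with them deleted); $\mathcal T_S$ is the span of those with $S_1\cup\cdots\cup S_k=S$, and $\hat{\mathcal T}=\prod_{S\in\mathcal P}\mathcal T_S$. The composition product: $1_{(S_1,\dots,S_p)}\circ 1_{(T_1,\dots,T_q)}=0$ if $\bigcup S_i\ne\bigcup T_j$, else $1_{(S_1\cap T_1,\dots,S_1\cap T_q,\dots,S_p\cap T_1,\dots,S_p\cap T_q)}$, extended componentwise to $\hat{\mathcal T}$. For a composition $(n_1,\dots,n_k)$ of $n$ (positive integers summing to $n$) and $|S|=n$, let $1_{n_1,\dots,n_k}(S)=\sum 1_{(S_1,\dots,S_k)}$ over ordered partitions of $S$ with $|S_i|=n_i$, and $1_{n_1,\dots,n_k}=\sum_{|S|=n}1_{n_1,\dots,n_k}(S)\in\hat{\mathcal T}$. $\mathcal D_n$ is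 the span of the elements $1_{n_1,\dots,n_k}$ over compositions of $n$ (these form a basis). $O_{n_1,\dots,n_k}:=1_{n_1,\dots,n_k}([n])\in\mathcal T_{[n]}$, and $\mathcal F_n$ is the span of the $O_{n_1,\dots,n_k}$ in $\mathcal T_{[n]}$ (the fixed space of the $S_n$-action $1_{(S_1,\dots,S_k)}\cdot\sigma=1_{(\sigma^{ -1}(S_1),\dots,\sigma^{ -1}(S_k))}$), which is closed under $\circ$. -}

module Defs where

open import Level using (Level; _⊔_)
open import Data.Bool using (Bool; true; false; _∧_; not; if_then_else_; T)
open import Data.Nat as ℕ using (ℕ; zero; suc; _≡ᵇ_; _<ᵇ_; _<_) renaming (_⊔_ to _⊔ℕ_)
open import Data.List using (List; []; _∷_; map; concat; concatMap; upTo; length; foldr)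
open import Data.Bool.ListAction using (all; any)
open import Data.Nat.ListAction using (sum)
open import Data.List.Relation.Unary.All using (All)
open import Data.Product using (Σ; _×_; _,_; proj₁; proj₂)
open import Relation.Binary.PropositionalEquality using (_≡_)
open import Relation.Nullary using (¬_)
open import Algebra.Bundles using (CommutativeRing)

record IsField {c ℓ : Level} (R : CommutativeRing c ℓ) : Set (c ⊔ ℓ) where
  open CommutativeRing R
  field
    1≉0     : ¬ (1# ≈ 0#)
    inverse : ∀ x → ¬ (x ≈ 0#) → Σ Carrier λ y → (x * y) ≈ 1#

filterB : {A : Set} → (A → Bool) → List A → List A
filterB p [] = []
filterB p (x ∷ xs) = if p x then x ∷ filterB p xs else filterB p xs

memb : ℕ → List ℕ → Bool
memb x = any (x ≡ᵇ_)

nodup : List ℕ → Bool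
nodup [] = true
nodup (x ∷ l) = not (memb x l) ∧ nodup l

strictInc : List ℕ → Bool
strictInc [] = true
strictInc (x ∷ []) = true
strictInc (x ∷ y ∷ l) = (x <ᵇ y) ∧ strictInc (y ∷ l)

nonEmpty : {A : Set} → List A → Bool
nonEmpty [] = false
nonEmpty (_ ∷ _) = true

eqL : List ℕ → List ℕ → Bool
eqL [] [] = true
eqL (x ∷ l) (y ∷ m) = (x ≡ᵇ y) ∧ eqL l m
eqL _ _ = false

eqLL : List (List ℕ) → List (List ℕ) → Bool
eqLL [] [] = true
eqLL (x ∷ l) (y ∷ m) = eqL x y ∧ eqLL l m
eqLL _ _ = false

maxL : List ℕ → ℕ
maxL = foldr _⊔ℕ_ 0

-- Finite subsets of N = {1,2,...} are represented canonically as strictly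
-- increasing lists of positive naturals.  A symbol 1_(S_1,...,S_k) is the
-- list of its blocks; it is a valid symbol iff every block is a nonempty
-- finite subset of N and the blocks are pairwise disjoint.

Symbol : Set
Symbol = List (List ℕ)

validBlock : List ℕ → Bool
validBlock b = nonEmpty b ∧ (strictInc b ∧ all (0 <ᵇ_) b)

valid : Symbol → Bool
valid c = all validBlock c ∧ nodup (concat c)

-- the underlying set S_1 ∪ ... ∪ S_k (as a sorted list)
support : Symbol → List ℕ
support c = filterB (λ x → memb x (concat c)) (upTo (suc (maxL (concat c))))

range : ℕ → List ℕ
range n = map suc (upTo n)

inter : List ℕ → List ℕ → List ℕ
inter A B = filterB (λ x → memb x B) A

meet : Symbol → Symbol → Symbol
meet a b = filterB nonEmpty (concatMap (λ A → map (inter A) b) a)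

words : ℕ → ℕ → List (List ℕ)
words zero r = [] ∷ []
words (suc m) r = concatMap (λ i → map (i ∷_) (words m r)) (upTo r)

nblocks : List ℕ → ℕ
nblocks [] = 0
nblocks (x ∷ w) = suc (maxL (x ∷ w))

surjW : List ℕ → Bool
surjW w = all (λ i → memb i w) (upTo (nblocks w))

pick : List ℕ → List ℕ → ℕ → List ℕ
pick (s ∷ S) (j ∷ w) i = if j ≡ᵇ i then s ∷ pick S w i else pick S w i
pick _ _ i = []

blocks : List ℕ → List ℕ → Symbol
blocks S w = map (pick S w) (upTo (nblocks w))

-- all ordered set partitions (S_1,...,S_k) of the finite set S,
-- each listed once (bijection with surjections S → {0,...,k-1})
setComps : List ℕ → List Symbol
setComps S = map (blocks S) (filterB surjW (words (length S) (length S)))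

IsComposition : ℕ → List ℕ → Set
IsComposition n α = All (0 <_) α × sum α ≡ n

-- The algebra \hat T over a commutative ring R: an element assigns a
-- coefficient to every symbol (= the family of its components T_S);
-- only valid symbols matter.

module Construction {c ℓ : Level} (R : CommutativeRing c ℓ) where
  open CommutativeRing R

  That : Set c
  That = Symbol → Carrier

  infix 4 _≈̂_
  _≈̂_ : That → That → Set ℓ
  f ≈̂ g = ∀ s → T (valid s) → f s ≈ g s

  sumR : List Carrier → Carrier
  sumR = foldr _+_ 0#

  infixl 7 _∘̂_
  _∘̂_ : That → That → That
  (f ∘̂ g) s = sumR (concatMap (λ a → map (λ b →
                   if eqLL (meet a b) s then f a * g b else 0#)
                 (setComps (support s))) (setComps (support s)))

  _·̂_ : Carrier → That → That
  (r ·̂ f) s = r * f s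

  _+̂_ : That → That → That
  (f +̂ g) s = f s + g s

  0̂ : That
  0̂ s = 0#

  -- 1_{n_1,...,n_k} = Σ_{|S|=n} Σ_{|S_i|=n_i} 1_{(S_1,...,S_k)}
  one : List ℕ → That
  one α s = if valid s ∧ eqL (map length s) α then 1# else 0#

  -- the S-component of an element of \hat T (as an element of T_S ⊆ \hat T)
  restrict : List ℕ → That → That
  restrict S f s = if eqL (support s) S then f s else 0#

  O : List ℕ → That
  O α = restrict (range (sum α)) (one α)

  lincomb : (List ℕ → That) → List (Carrier × List ℕ) → That
  lincomb e [] = 0̂
  lincomb e ((r , α) ∷ l) = (r ·̂ e α) +̂ lincomb e l

  InD : ℕ → That → Set (c ⊔ ℓ)
  InD n x = Σ (List (Carrier × List ℕ)) λ l →
              All (λ p → IsComposition n (proj₂ p)) l × (x ≈̂ lincomb one l)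

  InF : ℕ → That → Set (c ⊔ ℓ)
  InF n x = Σ (List (Carrier × List ℕ)) λ l →
              All (λ p → IsComposition n (proj₂ p)) l × (x ≈̂ lincomb O l)

  -- the map D_n → F_n, 1_α ↦ 1_α([n]) (extended linearly): it is
  -- taking the [n]-component
  φ : ℕ → That → That
  φ n = restrict (range n)

{-# OPTIONS --safe #-}
-- φ n restricts to the [n]-component, and ∘ is computed inside a single component (all ordered
-- partitions of the support of s have that same support), so φ n is linear and multiplicative on
-- all of T̂.  An element of D_n is a function of the shape (the block sizes) of a symbol that
-- vanishes on symbols whose size is not n; such a function is determined by its values on symbols
-- with support [n], so φ n is injective on D_n, and its image is F_n by definition.
--
-- The substance is that D_n is closed under ∘.  Writing a symbol s with support S of size N as the
-- blocks of a word w from positions 1..N to block indices, (x ∘ y)(s) becomes a double sum over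
-- words u, v whose summand sees S only through positions, namely through the indicator matrices of
-- u, v and w.  Permuting positions simultaneously in u, v, w permutes the summation, so the sum
-- depends on w only up to permutation, i.e. on its letter counts, which form the shape of s.
module Submission where

open import Defs
open import Level using (Level; _⊔_)
open import Function using (_∘_)
open import Function.Bundles using (Equivalence)
open import Data.Bool as Bool using (Bool; true; false; _∧_; _∨_; not; if_then_else_)
open import Data.Bool.Properties as Bool using (T-≡; T-not-≡)
open import Data.Bool.ListAction using (all; or)
open import Data.Nat using (ℕ; zero; suc; _∸_; _≤_; _<_; z≤n; s≤s; _≡ᵇ_; _<ᵇ_; _⊓_)
import Data.Nat as ℕ
open import Data.Nat.Properties as ℕ
  using ( _≟_; ≡ᵇ⇒≡; ≡⇒≡ᵇ; <ᵇ⇒<; <⇒<ᵇ; <-trans; <-irrefl; <⇒≢; ≤-refl; ≤-trans; ≤-antisym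
        ; m≤m⊔n; m≤n⊔m; ⊔-lub; ⊓-idem; suc-injective)
open import Data.Nat.ListAction using (sum)
open import Data.List
  using (List; []; _∷_; _++_; map; concat; concatMap; upTo; applyUpTo; length; foldr; zipWith; replicate)
open import Data.List.Properties
  using ( map-cong; map-∘; map-++; map-id; map-upTo; map-concatMap; length-map; length-upTo; length-zipWith
        ; ≡-dec; ∷-injective)
open import Data.List.Relation.Unary.All as All using (All; []; _∷_)
open import Data.List.Relation.Unary.All.Properties as All using ()
open import Data.List.Relation.Unary.Any as Any using (here; there)
open import Data.List.Relation.Unary.Any.Properties using (any⁺; any⁻)
open import Data.List.Relation.Unary.AllPairs as AllPairs using (AllPairs; []; _∷_)
open import Data.List.Relation.Unary.AllPairs.Properties as AllPairs using ()
open import Data.List.Membership.Propositional using (_∈_; _∉_)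
open import Data.List.Membership.Propositional.Properties
  using (∈-upTo⁺; ∈-upTo⁻; ∈-map⁺; ∈-map⁻; ∈-concat⁺′; ∈-concat⁻′; ∈-++⁺ˡ; ∈-++⁺ʳ; ∈-++⁻)
open import Data.List.Relation.Binary.Permutation.Propositional as ↭
  using (_↭_; ↭-reflexive; ↭-prep; ↭-trans; ↭-sym)
open import Data.List.Relation.Binary.Permutation.Propositional.Properties using (shift; ++⁺ˡ)
open import Data.Product as Product using (Σ; _×_; _,_; proj₁; proj₂)
open import Data.Sum using (inj₁; inj₂)
open import Data.Empty using (⊥-elim)
open import Relation.Binary.PropositionalEquality
  using (_≡_; _≢_; refl; sym; trans; cong; cong₂; subst; module ≡-Reasoning)
open import Relation.Nullary using (¬_)
open import Relation.Nullary.Decidable using (Dec; yes; no; does; dec-true; dec-false)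
open import Relation.Binary.Bundles using (Setoid)
open import Algebra.Bundles using (CommutativeMonoid; CommutativeRing)
open import Algebra.Properties.CommutativeSemigroup as CommutativeSemigroupProperties using (x∙yz≈y∙xz)

open Equivalence using (to; from)

∧-true⁻ : ∀ {a b} → a ∧ b ≡ true → a ≡ true × b ≡ true
∧-true⁻ {true} {true} _ = refl , refl

∧-true⁺ : ∀ {a b} → a ≡ true → b ≡ true → a ∧ b ≡ true
∧-true⁺ refl refl = refl

≡ᵇ-true⇒≡ : ∀ {m n} → (m ≡ᵇ n) ≡ true → m ≡ n
≡ᵇ-true⇒≡ {m} {n} e = ≡ᵇ⇒≡ m n (from T-≡ e)

≡ᵇ-refl : ∀ n → (n ≡ᵇ n) ≡ true
≡ᵇ-refl n = dec-true (n ≟ n) refl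

≢⇒≡ᵇ-false : ∀ {m n} → m ≢ n → (m ≡ᵇ n) ≡ false
≢⇒≡ᵇ-false {m} {n} = dec-false (m ≟ n)

≡ᵇ-false⇒≢ : ∀ {m n} → (m ≡ᵇ n) ≡ false → m ≢ n
≡ᵇ-false⇒≢ {m} e refl with () ← trans (sym (≡ᵇ-refl m)) e

≡ᵇ-sym : ∀ m n → (m ≡ᵇ n) ≡ (n ≡ᵇ m)
≡ᵇ-sym zero    zero    = refl
≡ᵇ-sym zero    (suc n) = refl
≡ᵇ-sym (suc m) zero    = refl
≡ᵇ-sym (suc m) (suc n) = ≡ᵇ-sym m n

<ᵇ-true⇒< : ∀ {m n} → (m <ᵇ n) ≡ true → m < n
<ᵇ-true⇒< {m} {n} e = <ᵇ⇒< m n (from T-≡ e)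

<⇒<ᵇ-true : ∀ {m n} → m < n → (m <ᵇ n) ≡ true
<⇒<ᵇ-true m<n = to T-≡ (<⇒<ᵇ m<n)

<ᵇ-false⇒≮ : ∀ {m n} → (m <ᵇ n) ≡ false → ¬ (m < n)
<ᵇ-false⇒≮ e m<n with () ← trans (sym (<⇒<ᵇ-true m<n)) e

memb-true⇒∈ : ∀ {x} l → memb x l ≡ true → x ∈ l
memb-true⇒∈ {x} l e = Any.map (≡ᵇ⇒≡ x _) (any⁻ (x ≡ᵇ_) l (from T-≡ e))

∈⇒memb-true : ∀ {x l} → x ∈ l → memb x l ≡ true
∈⇒memb-true {x} x∈l = to T-≡ (any⁺ (x ≡ᵇ_) (Any.map (≡⇒≡ᵇ x _) x∈l))

∉⇒memb-false : ∀ {x} l → x ∉ l → memb x l ≡ false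
∉⇒memb-false {x} l x∉l with memb x l in e
... | true  = ⊥-elim (x∉l (memb-true⇒∈ l e))
... | false = refl

memb-false⇒∉ : ∀ {x} l → memb x l ≡ false → x ∉ l
memb-false⇒∉ l e x∈l with () ← trans (sym (∈⇒memb-true x∈l)) e

memb-cong : ∀ {x} L L′ → (x ∈ L → x ∈ L′) → (x ∈ L′ → x ∈ L) → memb x L ≡ memb x L′
memb-cong {x} L L′ f g with memb x L in e | memb x L′ in e′
... | true  | true  = refl
... | false | false = refl
... | true  | false = ⊥-elim (memb-false⇒∉ L′ e′ (f (memb-true⇒∈ L e)))
... | false | true  = ⊥-elim (memb-false⇒∉ L e (g (memb-true⇒∈ L′ e′)))

all-true⇒All : ∀ {A : Set} (p : A → Bool) l → all p l ≡ true → All (λ x → p x ≡ true) l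
all-true⇒All p l e = All.map (to T-≡) (All.all⁺ p l (from T-≡ e))

All⇒all-true : ∀ {A : Set} (p : A → Bool) {l} → All (λ x → p x ≡ true) l → all p l ≡ true
All⇒all-true p ps = to T-≡ (All.all⁻ p (All.map (from T-≡) ps))

all-cong : ∀ {A : Set} {p q : A → Bool} l → (∀ x → p x ≡ q x) → all p l ≡ all q l
all-cong []      e = refl
all-cong (x ∷ l) e = cong₂ _∧_ (e x) (all-cong l e)

strictInc⇒AllPairs : ∀ l → strictInc l ≡ true → AllPairs _<_ l
strictInc⇒AllPairs []          _ = []
strictInc⇒AllPairs (x ∷ [])    _ = [] ∷ []
strictInc⇒AllPairs (x ∷ y ∷ l) e =
  extend (<ᵇ-true⇒< (proj₁ (∧-true⁻ {x <ᵇ y} e))) (strictInc⇒AllPairs (y ∷ l) (proj₂ (∧-true⁻ {x <ᵇ y} e)))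
  where
  extend : x < y → AllPairs _<_ (y ∷ l) → AllPairs _<_ (x ∷ y ∷ l)
  extend x<y (y<l ∷ l<) = (x<y ∷ All.map (<-trans x<y) y<l) ∷ y<l ∷ l<

AllPairs⇒strictInc : ∀ {l} → AllPairs _<_ l → strictInc l ≡ true
AllPairs⇒strictInc []                        = refl
AllPairs⇒strictInc (_ ∷ [])                  = refl
AllPairs⇒strictInc ((x<y ∷ _) ∷ l<@(_ ∷ _)) = ∧-true⁺ (<⇒<ᵇ-true x<y) (AllPairs⇒strictInc l<)

nodup⇒AllPairs : ∀ l → nodup l ≡ true → AllPairs _≢_ l
nodup⇒AllPairs []      _ = []
nodup⇒AllPairs (x ∷ l) e with ∧-true⁻ {not (memb x l)} e
... | x∉l , rest = All.tabulate (λ y∈l x≡y → memb-false⇒∉ l (to T-not-≡ (from T-≡ x∉l)) (subst (_∈ l) (sym x≡y) y∈l))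
                 ∷ nodup⇒AllPairs l rest

AllPairs⇒nodup : ∀ {l} → AllPairs _≢_ l → nodup l ≡ true
AllPairs⇒nodup []                  = refl
AllPairs⇒nodup {x ∷ l} (x≢l ∷ l≢) rewrite ∉⇒memb-false l (λ x∈l → All.lookup x≢l x∈l refl) = AllPairs⇒nodup l≢

_≟ᴸ_ : (a b : List ℕ) → Dec (a ≡ b)
_≟ᴸ_ = ≡-dec _≟_

_≟ˢ_ : (a b : Symbol) → Dec (a ≡ b)
_≟ˢ_ = ≡-dec _≟ᴸ_

_≟ᴹ_ : (A B : List (List Bool)) → Dec (A ≡ B)
_≟ᴹ_ = ≡-dec (≡-dec Bool._≟_)

does-⇔ : ∀ {P Q : Set} (P? : Dec P) (Q? : Dec Q) → (P → Q) → (Q → P) → does P? ≡ does Q?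
does-⇔ (yes _) (yes _) _ _ = refl
does-⇔ (no  _) (no  _) _ _ = refl
does-⇔ (yes p) (no ¬q) f _ = ⊥-elim (¬q (f p))
does-⇔ (no ¬p) (yes q) _ g = ⊥-elim (¬p (g q))

eqL≡does : ∀ a b → eqL a b ≡ does (a ≟ᴸ b)
eqL≡does []      []      = refl
eqL≡does []      (_ ∷ _) = refl
eqL≡does (_ ∷ _) []      = refl
eqL≡does (x ∷ a) (y ∷ b) = cong ((x ≡ᵇ y) ∧_) (eqL≡does a b)

eqLL≡does : ∀ a b → eqLL a b ≡ does (a ≟ˢ b)
eqLL≡does []      []      = refl
eqLL≡does []      (_ ∷ _) = refl
eqLL≡does (_ ∷ _) []      = refl
eqLL≡does (x ∷ a) (y ∷ b) = cong₂ _∧_ (eqL≡does x y) (eqLL≡does a b)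

eqL-refl : ∀ a → eqL a a ≡ true
eqL-refl a = trans (eqL≡does a a) (dec-true (a ≟ᴸ a) refl)

eqL-true⇒≡ : ∀ {a b} → eqL a b ≡ true → a ≡ b
eqL-true⇒≡ {a} {b} e with a ≟ᴸ b | eqL≡does a b
... | yes a≡b | _  = a≡b
... | no  _   | e′ with () ← trans (sym e) e′

module _ {A : Set} where

  filterB-cong : ∀ {p q : A → Bool} {l} → All (λ x → p x ≡ q x) l → filterB p l ≡ filterB q l
  filterB-cong [] = refl
  filterB-cong {p} {q} (e ∷ es) rewrite e | filterB-cong {p} {q} es = refl

  ∈-filterB⁻ : ∀ (p : A → Bool) {x} l → x ∈ filterB p l → x ∈ l × p x ≡ true
  ∈-filterB⁻ p (y ∷ l) x∈ with p y in py
  ∈-filterB⁻ p (y ∷ l) (here refl) | true  = here refl , py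
  ∈-filterB⁻ p (y ∷ l) (there x∈)  | true  = Product.map₁ there (∈-filterB⁻ p l x∈)
  ∈-filterB⁻ p (y ∷ l) x∈          | false = Product.map₁ there (∈-filterB⁻ p l x∈)

  ∈-filterB⁺ : ∀ (p : A → Bool) {x l} → x ∈ l → p x ≡ true → x ∈ filterB p l
  ∈-filterB⁺ p (here refl) px rewrite px = here refl
  ∈-filterB⁺ p {l = y ∷ l} (there x∈) px with p y
  ... | true  = there (∈-filterB⁺ p x∈ px)
  ... | false = ∈-filterB⁺ p x∈ px

  All-filterB⁺ : ∀ {ℓ} {P : A → Set ℓ} (p : A → Bool) {l} → All P l → All (λ x → P x × p x ≡ true) (filterB p l)
  All-filterB⁺ p [] = []
  All-filterB⁺ p {x ∷ l} (Px ∷ Pl) with p x in px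
  ... | true  = (Px , px) ∷ All-filterB⁺ p Pl
  ... | false = All-filterB⁺ p Pl

  filterB-All : ∀ {ℓ} {P : A → Set ℓ} (p : A → Bool) {l} → All P l → All P (filterB p l)
  filterB-All p = All.map proj₁ ∘ All-filterB⁺ p

  filterB-AllPairs : ∀ {R : A → A → Set} (p : A → Bool) {l} → AllPairs R l → AllPairs R (filterB p l)
  filterB-AllPairs p [] = []
  filterB-AllPairs p {x ∷ l} (Rx ∷ Rl) with p x
  ... | true  = filterB-All p Rx ∷ filterB-AllPairs p Rl
  ... | false = filterB-AllPairs p Rl

  filterB-none : ∀ (p : A → Bool) {l} → All (λ x → p x ≡ false) l → filterB p l ≡ []
  filterB-none p [] = refl
  filterB-none p (px ∷ pl) rewrite px = filterB-none p pl

filterB-map : ∀ {A B : Set} (p : B → Bool) (f : A → B) l → filterB p (map f l) ≡ map f (filterB (p ∘ f) l)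
filterB-map p f [] = refl
filterB-map p f (x ∷ l) with p (f x)
... | true  = cong (f x ∷_) (filterB-map p f l)
... | false = filterB-map p f l

pairwise : ∀ {X : Set} → (X → X → X) → List X → List X → List X
pairwise _⊗_ A B = concatMap (λ a → map (a ⊗_) B) A

All-pairwise : ∀ {X : Set} {P : X → Set} (_⊗_ : X → X → X) A B → (∀ {a b} → a ∈ A → b ∈ B → P (a ⊗ b)) →
               All P (pairwise _⊗_ A B)
All-pairwise _⊗_ A B P⊗ = All.concat⁺ (All.map⁺ (All.tabulate (λ a∈ → All.map⁺ (All.tabulate (λ b∈ → P⊗ a∈ b∈)))))

module _ {X Y : Set} {_⊗_ : X → X → X} {_⊕_ : Y → Y → Y} (f : X → Y) where

  pairwise-map : ∀ A B → (∀ {a b} → a ∈ A → b ∈ B → f a ⊕ f b ≡ f (a ⊗ b)) →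
                 pairwise _⊕_ (map f A) (map f B) ≡ map f (pairwise _⊗_ A B)
  pairwise-map []      B hom = refl
  pairwise-map (a ∷ A) B hom =
    trans (cong₂ _++_ (row B (hom (here refl))) (pairwise-map A B (hom ∘ there))) (sym (map-++ f (map (a ⊗_) B) _))
    where
    row : ∀ B → (∀ {b} → b ∈ B → f a ⊕ f b ≡ f (a ⊗ b)) → map (f a ⊕_) (map f B) ≡ map f (map (a ⊗_) B)
    row []      _   = refl
    row (b ∷ B) hom = cong₂ _∷_ (hom (here refl)) (row B (hom ∘ there))

  filterB-pairwise-map : ∀ {p : X → Bool} {q : Y → Bool} A B →
                         (∀ {a b} → a ∈ A → b ∈ B → f a ⊕ f b ≡ f (a ⊗ b)) →
                         (∀ {a b} → a ∈ A → b ∈ B → q (f (a ⊗ b)) ≡ p (a ⊗ b)) →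
                         filterB q (pairwise _⊕_ (map f A) (map f B)) ≡ map f (filterB p (pairwise _⊗_ A B))
  filterB-pairwise-map {p} {q} A B hom q∘f≡p = begin
      filterB q (pairwise _⊕_ (map f A) (map f B))  ≡⟨ cong (filterB q) (pairwise-map A B hom) ⟩
      filterB q (map f (pairwise _⊗_ A B))          ≡⟨ filterB-map q f (pairwise _⊗_ A B) ⟩
      map f (filterB (q ∘ f) (pairwise _⊗_ A B))    ≡⟨ cong (map f) (filterB-cong (All-pairwise _⊗_ A B q∘f≡p)) ⟩
      map f (filterB p (pairwise _⊗_ A B))          ∎
    where open ≡-Reasoning

upTo-increasing : ∀ n → AllPairs _<_ (upTo n)
upTo-increasing n = AllPairs.applyUpTo⁺₁ (λ i → i) n (λ i<j _ → i<j)

upTo-distinct : ∀ n → AllPairs _≢_ (upTo n)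
upTo-distinct n = AllPairs.map <⇒≢ (upTo-increasing n)

nth : ∀ {A : Set} → A → List A → ℕ → A
nth d []      _       = d
nth d (x ∷ l) zero    = x
nth d (x ∷ l) (suc i) = nth d l i

nth-∈ : ∀ {A : Set} {d : A} l {i} → i < length l → nth d l i ∈ l
nth-∈ (x ∷ l) {zero}  _         = here refl
nth-∈ (x ∷ l) {suc i} (s≤s i<l) = there (nth-∈ l i<l)

nth-map-upTo : ∀ {A : Set} {d : A} (f : ℕ → A) n {i} → i < n → nth d (map f (upTo n)) i ≡ f i
nth-map-upTo f n {i} i<n = trans (cong (λ l → nth _ l i) (map-upTo f n)) (go f n i<n)
  where
  go : ∀ f n {i} → i < n → nth _ (applyUpTo f n) i ≡ f i
  go f (suc n) {zero}  _         = refl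
  go f (suc n) {suc i} (s≤s i<n) = go (f ∘ suc) n i<n

map-upTo-nth : ∀ {A : Set} {d : A} l (f : ℕ → A) → (∀ {i} → i < length l → f i ≡ nth d l i) →
               map f (upTo (length l)) ≡ l
map-upTo-nth l f f≗ = trans (map-upTo f (length l)) (go l f f≗)
  where
  go : ∀ l f → (∀ {i} → i < length l → f i ≡ nth _ l i) → applyUpTo f (length l) ≡ l
  go []      f _  = refl
  go (x ∷ l) f f≗ = cong₂ _∷_ (f≗ (s≤s z≤n)) (go l (f ∘ suc) (f≗ ∘ s≤s))

AllPairs-++⁻ : ∀ {R : ℕ → ℕ → Set} xs {ys} → AllPairs R (xs ++ ys) → All (λ x → All (R x) ys) xs × AllPairs R ys
AllPairs-++⁻ []       R-ys            = [] , R-ys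
AllPairs-++⁻ (x ∷ xs) (R-x ∷ R-xsys) =
  Product.map₁ (All.++⁻ʳ xs R-x ∷_) (AllPairs-++⁻ xs R-xsys)

∈-maxL : ∀ {x} l → x ∈ l → x ≤ maxL l
∈-maxL (y ∷ l) (here refl) = m≤m⊔n y (maxL l)
∈-maxL (y ∷ l) (there x∈l) = ≤-trans (∈-maxL l x∈l) (m≤n⊔m y (maxL l))

maxL-lub : ∀ {m} l → All (_≤ m) l → maxL l ≤ m
maxL-lub [] [] = z≤n
maxL-lub (y ∷ l) (y≤m ∷ l≤m) = ⊔-lub y≤m (maxL-lub l l≤m)

maxL-memb-cong : ∀ L L′ → (∀ x → memb x L ≡ memb x L′) → maxL L ≡ maxL L′
maxL-memb-cong L L′ e = ≤-antisym (bound L L′ e) (bound L′ L (λ x → sym (e x)))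
  where
  bound : ∀ L L′ → (∀ x → memb x L ≡ memb x L′) → maxL L ≤ maxL L′
  bound L L′ e = maxL-lub L (All.tabulate (λ {x} x∈L →
    ∈-maxL L′ (memb-true⇒∈ L′ (trans (sym (e x)) (∈⇒memb-true x∈L)))))

filterB-memb-⊆ : ∀ {A} T → AllPairs _<_ A → AllPairs _<_ T → All (_∈ T) A → filterB (λ x → memb x A) T ≡ A
filterB-memb-⊆ [] _ _ [] = refl
filterB-memb-⊆ {A} (y ∷ T) A< (y<T ∷ T<) A⊆ with memb y A in y∈?
... | true  = headed A A< A⊆ (memb-true⇒∈ A y∈?)
  where
  headed : ∀ A → AllPairs _<_ A → All (_∈ y ∷ T) A → y ∈ A → y ∷ filterB (λ x → memb x A) T ≡ A
  headed (a ∷ A) (a<A ∷ A<) (here refl ∷ A⊆) _ = cong (y ∷_) (trans dropY (filterB-memb-⊆ T A< T< A⊆T))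
    where
    dropY : filterB (λ x → memb x (y ∷ A)) T ≡ filterB (λ x → memb x A) T
    dropY = filterB-cong (All.map (λ {z} y<z → cong (_∨ memb z A) (≢⇒≡ᵇ-false (<⇒≢ y<z ∘ sym))) y<T)
    A⊆T : All (_∈ T) A
    A⊆T = All.zipWith (λ { (here refl , y<y) → ⊥-elim (<-irrefl refl y<y) ; (there z∈T , _) → z∈T }) (A⊆ , a<A)
  headed (a ∷ A) _          (there a∈T ∷ _) (here refl) = ⊥-elim (<-irrefl refl (All.lookup y<T a∈T))
  headed (a ∷ A) (a<A ∷ _)  (there a∈T ∷ _) (there y∈A) =
    ⊥-elim (<-irrefl refl (<-trans (All.lookup a<A y∈A) (All.lookup y<T a∈T)))
... | false = filterB-memb-⊆ T A< T< (All.tabulate (λ {z} z∈A → notY (All.lookup A⊆ z∈A) z∈A))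
  where
  notY : ∀ {z} → z ∈ y ∷ T → z ∈ A → z ∈ T
  notY (here refl) z∈A = ⊥-elim (memb-false⇒∉ A y∈? z∈A)
  notY (there z∈T) _   = z∈T

sortedElements : List ℕ → List ℕ
sortedElements L = filterB (λ x → memb x L) (upTo (suc (maxL L)))

sortedElements-increasing : ∀ L → AllPairs _<_ (sortedElements L)
sortedElements-increasing L = filterB-AllPairs _ (upTo-increasing (suc (maxL L)))

∈-sortedElements⁻ : ∀ {x} L → x ∈ sortedElements L → x ∈ L
∈-sortedElements⁻ L x∈ = memb-true⇒∈ L (proj₂ (∈-filterB⁻ _ (upTo (suc (maxL L))) x∈))

∈-sortedElements⁺ : ∀ {x} L → x ∈ L → x ∈ sortedElements L
∈-sortedElements⁺ L x∈ = ∈-filterB⁺ _ (∈-upTo⁺ (s≤s (∈-maxL L x∈))) (∈⇒memb-true x∈)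

sortedElements-cong : ∀ L L′ → (∀ x → memb x L ≡ memb x L′) → sortedElements L ≡ sortedElements L′
sortedElements-cong L L′ e rewrite maxL-memb-cong L L′ e =
  filterB-cong {l = upTo (suc (maxL L′))} (All.tabulate (λ {x} _ → e x))

increasing⇒sortedElements≡ : ∀ S → AllPairs _<_ S → sortedElements S ≡ S
increasing⇒sortedElements≡ S S< =
  filterB-memb-⊆ (upTo (suc (maxL S))) S< (upTo-increasing _) (All.tabulate (λ x∈ → ∈-upTo⁺ (s≤s (∈-maxL S x∈))))

-- Finite sums in a commutative monoid

module Sums {c ℓ : Level} (M : CommutativeMonoid c ℓ) where
  open CommutativeMonoid M
    using (Carrier; _≈_; _∙_; ε; ∙-cong; ∙-congˡ; assoc; identityˡ; identityʳ; commutativeSemigroup)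
    renaming (refl to ≈-refl; sym to ≈-sym; trans to ≈-trans; reflexive to ≈-reflexive)
  open CommutativeSemigroupProperties commutativeSemigroup using (interchange)

  Σ[_] : List Carrier → Carrier
  Σ[_] = foldr _∙_ ε

  when : Bool → Carrier → Carrier
  when b x = if b then x else ε

  when-cong : ∀ b {x y} → x ≈ y → when b x ≈ when b y
  when-cong true  x≈y = x≈y
  when-cong false _   = ≈-refl

  when-ε : ∀ b → when b ε ≡ ε
  when-ε true  = refl
  when-ε false = refl

  when-∧ : ∀ a b x → when (a ∧ b) x ≡ when a (when b x)
  when-∧ true  b x = refl
  when-∧ false b x = refl

  module _ {A : Set} where

    Σ-++ : ∀ xs ys → Σ[ xs ++ ys ] ≈ Σ[ xs ] ∙ Σ[ ys ]
    Σ-++ []       ys = ≈-sym (identityˡ _)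
    Σ-++ (x ∷ xs) ys = ≈-trans (∙-congˡ (Σ-++ xs ys)) (≈-sym (assoc x _ _))

    Σ-concatMap : ∀ (h : A → List Carrier) L → Σ[ concatMap h L ] ≈ Σ[ map (λ a → Σ[ h a ]) L ]
    Σ-concatMap h []      = ≈-refl
    Σ-concatMap h (a ∷ L) = ≈-trans (Σ-++ (h a) _) (∙-congˡ (Σ-concatMap h L))

    Σ-map-concatMap : ∀ {B : Set} (f : B → Carrier) (h : A → List B) L →
                      Σ[ map f (concatMap h L) ] ≈ Σ[ map (λ a → Σ[ map f (h a) ]) L ]
    Σ-map-concatMap f h L = ≈-trans (≈-reflexive (cong Σ[_] (map-concatMap f h L))) (Σ-concatMap (map f ∘ h) L)

    Σ-cong-All : ∀ {f g : A → Carrier} {L} → All (λ a → f a ≈ g a) L → Σ[ map f L ] ≈ Σ[ map g L ]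
    Σ-cong-All []       = ≈-refl
    Σ-cong-All (e ∷ es) = ∙-cong e (Σ-cong-All es)

    Σ-cong : ∀ {f g : A → Carrier} L → (∀ a → f a ≈ g a) → Σ[ map f L ] ≈ Σ[ map g L ]
    Σ-cong L f≈g = Σ-cong-All (All.tabulate {xs = L} (λ {a} _ → f≈g a))

    Σ-zero-All : ∀ {f : A → Carrier} {L} → All (λ a → f a ≈ ε) L → Σ[ map f L ] ≈ ε
    Σ-zero-All []       = ≈-refl
    Σ-zero-All (e ∷ es) = ≈-trans (∙-cong e (Σ-zero-All es)) (identityˡ ε)

    Σ-zero : ∀ {f : A → Carrier} L → (∀ a → f a ≈ ε) → Σ[ map f L ] ≈ ε
    Σ-zero L f≈ε = Σ-zero-All (All.tabulate {xs = L} (λ {a} _ → f≈ε a))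

    Σ-∙ : ∀ (f g : A → Carrier) L → Σ[ map (λ a → f a ∙ g a) L ] ≈ Σ[ map f L ] ∙ Σ[ map g L ]
    Σ-∙ f g []      = ≈-sym (identityˡ ε)
    Σ-∙ f g (a ∷ L) = ≈-trans (∙-congˡ (Σ-∙ f g L)) (interchange (f a) (g a) _ _)

    Σ-filterB : ∀ (f : A → Carrier) (p : A → Bool) L → Σ[ map f (filterB p L) ] ≈ Σ[ map (λ a → when (p a) (f a)) L ]
    Σ-filterB f p []      = ≈-refl
    Σ-filterB f p (a ∷ L) with p a
    ... | true  = ∙-congˡ (Σ-filterB f p L)
    ... | false = ≈-trans (Σ-filterB f p L) (≈-sym (identityˡ _))

    Σ-when : ∀ b (f : A → Carrier) L → when b Σ[ map f L ] ≈ Σ[ map (when b ∘ f) L ]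
    Σ-when true  f L = ≈-refl
    Σ-when false f L = ≈-sym (Σ-zero L (λ _ → ≈-refl))

  Σ-swap : ∀ {A B : Set} (g : A → B → Carrier) L₁ L₂ →
           Σ[ map (λ a → Σ[ map (g a) L₂ ]) L₁ ] ≈ Σ[ map (λ b → Σ[ map (λ a → g a b) L₁ ]) L₂ ]
  Σ-swap g []       L₂ = ≈-sym (Σ-zero L₂ (λ _ → ≈-refl))
  Σ-swap g (a ∷ L₁) L₂ = ≈-trans (∙-congˡ (Σ-swap g L₁ L₂)) (≈-sym (Σ-∙ (g a) _ L₂))

  Σ-when-≡ᵇ-∉ : ∀ {j} (f : ℕ → Carrier) L → j ∉ L → Σ[ map (λ k → when (j ≡ᵇ k) (f k)) L ] ≈ ε
  Σ-when-≡ᵇ-∉ {j} f L j∉L = Σ-zero-All (All.tabulate {xs = L} (λ {k} k∈L →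
    ≈-reflexive (cong (λ b → when b (f k)) (≢⇒≡ᵇ-false {j} {k} (λ { refl → j∉L k∈L })))))

  Σ-when-≡ᵇ-∈ : ∀ {j} (f : ℕ → Carrier) L → AllPairs _≢_ L → j ∈ L → Σ[ map (λ k → when (j ≡ᵇ k) (f k)) L ] ≈ f j
  Σ-when-≡ᵇ-∈ {j} f (j ∷ L) (j≢L ∷ _) (here refl) rewrite ≡ᵇ-refl j =
    ≈-trans (∙-congˡ (Σ-when-≡ᵇ-∉ f L (λ j∈L → All.lookup j≢L j∈L refl))) (identityʳ _)
  Σ-when-≡ᵇ-∈ {j} f (k ∷ L) (k≢L ∷ L≢) (there j∈L) rewrite ≢⇒≡ᵇ-false {j} {k} (λ j≡k → All.lookup k≢L j∈L (sym j≡k)) =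
    ≈-trans (identityˡ _) (Σ-when-≡ᵇ-∈ f L L≢ j∈L)

  Σ-upTo-when-≡ᵇ : ∀ j m (f : ℕ → Carrier) → Σ[ map (λ k → when (j ≡ᵇ k) (f k)) (upTo m) ] ≈ when (j <ᵇ m) (f j)
  Σ-upTo-when-≡ᵇ j m f with j <ᵇ m in j<ᵇm
  ... | true  = Σ-when-≡ᵇ-∈ {j} f (upTo m) (upTo-distinct m) (∈-upTo⁺ (<ᵇ-true⇒< j<ᵇm))
  ... | false = Σ-when-≡ᵇ-∉ {j} f (upTo m) (<ᵇ-false⇒≮ j<ᵇm ∘ ∈-upTo⁻)

-- Selection along Boolean masks

select : List ℕ → List Bool → List ℕ
select (x ∷ S) (b ∷ m) = if b then x ∷ select S m else select S m
select _       _       = []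

indicator : List ℕ → ℕ → List Bool
indicator u i = map (_≡ᵇ i) u

indicators : List ℕ → List (List Bool)
indicators u = map (indicator u) (upTo (nblocks u))

Matrix : ℕ → List (List Bool) → Set
Matrix N = All (λ row → length row ≡ N)

meetRows : List (List Bool) → List (List Bool) → List (List Bool)
meetRows A B = filterB or (pairwise (zipWith _∧_) A B)

select-∈ : ∀ {x S} m → x ∈ select S m → x ∈ S
select-∈ {S = y ∷ S} (true  ∷ m) (here refl) = here refl
select-∈ {S = y ∷ S} (true  ∷ m) (there x∈) = there (select-∈ m x∈)
select-∈ {S = y ∷ S} (false ∷ m) x∈         = there (select-∈ m x∈)

select-All : ∀ {P : ℕ → Set} {S} m → All P S → All P (select S m)
select-All {S = []}    _           _          = []
select-All {S = _ ∷ _} []          _          = []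
select-All             (true  ∷ m) (Px ∷ PS) = Px ∷ select-All m PS
select-All             (false ∷ m) (Px ∷ PS) = select-All m PS

select-AllPairs : ∀ {R : ℕ → ℕ → Set} {S} m → AllPairs R S → AllPairs R (select S m)
select-AllPairs {S = []}    _           _          = []
select-AllPairs {S = _ ∷ _} []          _          = []
select-AllPairs             (true  ∷ m) (Rx ∷ RS) = select-All m Rx ∷ select-AllPairs m RS
select-AllPairs             (false ∷ m) (Rx ∷ RS) = select-AllPairs m RS

nonEmpty-select : ∀ S m → length m ≡ length S → nonEmpty (select S m) ≡ or m
nonEmpty-select []      []          _ = refl
nonEmpty-select (x ∷ S) (true  ∷ m) _ = refl
nonEmpty-select (x ∷ S) (false ∷ m) e = nonEmpty-select S m (suc-injective e)

select-inter : ∀ S α β → AllPairs _≢_ S → inter (select S α) (select S β) ≡ select S (zipWith _∧_ α β)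
select-inter []      _       _       _ = refl
select-inter (x ∷ S) []      _       _ = refl
select-inter (x ∷ S) (a ∷ α) []      _ = filterB-none _ {select (x ∷ S) (a ∷ α)} (All.tabulate (λ _ → refl))
select-inter (x ∷ S) (a ∷ α) (b ∷ β) (x≢S ∷ S≢) = by-cases a b
  where
  x∉β : memb x (select S β) ≡ false
  x∉β = ∉⇒memb-false (select S β) (λ x∈ → All.lookup x≢S (select-∈ β x∈) refl)
  dropX : ∀ b → inter (select S α) (if b then x ∷ select S β else select S β) ≡ select S (zipWith _∧_ α β)
  dropX true  = trans (filterB-cong (All.map (λ {z} x≢z → cong (_∨ memb z (select S β)) (≢⇒≡ᵇ-false (x≢z ∘ sym)))
                                             (select-All α x≢S)))
                      (select-inter S α β S≢)
  dropX false = select-inter S α β S≢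
  by-cases : ∀ a b → inter (if a then x ∷ select S α else select S α) (if b then x ∷ select S β else select S β)
                   ≡ select (x ∷ S) (zipWith _∧_ (a ∷ α) (b ∷ β))
  by-cases true  true  rewrite ≡ᵇ-refl x = cong (x ∷_) (dropX true)
  by-cases true  false rewrite x∉β      = dropX false
  by-cases false b                       = dropX b

select-injective : ∀ {S α β} → AllPairs _≢_ S → length α ≡ length S → length β ≡ length S →
                   select S α ≡ select S β → α ≡ β
select-injective {[]}    {[]}        {[]}        _          _  _  _ = refl
select-injective {x ∷ S} {true  ∷ α} {true  ∷ β} (_ ∷ S≢) eα eβ e =
  cong (true ∷_) (select-injective S≢ (suc-injective eα) (suc-injective eβ) (proj₂ (∷-injective e)))
select-injective {x ∷ S} {false ∷ α} {false ∷ β} (_ ∷ S≢) eα eβ e =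
  cong (false ∷_) (select-injective S≢ (suc-injective eα) (suc-injective eβ) e)
select-injective {x ∷ S} {true  ∷ α} {false ∷ β} (x≢S ∷ _) _ _ e =
  ⊥-elim (All.lookup x≢S (select-∈ β (subst (x ∈_) e (here refl))) refl)
select-injective {x ∷ S} {false ∷ α} {true  ∷ β} (x≢S ∷ _) _ _ e =
  ⊥-elim (All.lookup x≢S (select-∈ α (subst (x ∈_) (sym e) (here refl))) refl)

map-select-injective : ∀ {S N A B} → AllPairs _≢_ S → length S ≡ N → Matrix N A → Matrix N B →
                       map (select S) A ≡ map (select S) B → A ≡ B
map-select-injective {A = []}    {[]}    _  _  _         _         _ = refl
map-select-injective {A = α ∷ A} {β ∷ B} S≢ eS (eα ∷ eA) (eβ ∷ eB) e =
  cong₂ _∷_ (select-injective S≢ (trans eα (sym eS)) (trans eβ (sym eS)) (proj₁ (∷-injective e)))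
            (map-select-injective S≢ eS eA eB (proj₂ (∷-injective e)))

eqLL-map-select : ∀ {S N} A B → AllPairs _≢_ S → length S ≡ N → Matrix N A → Matrix N B →
                  eqLL (map (select S) A) (map (select S) B) ≡ does (A ≟ᴹ B)
eqLL-map-select {S} A B S≢ eS eA eB = trans (eqLL≡does (map (select S) A) (map (select S) B))
  (does-⇔ (map (select S) A ≟ˢ map (select S) B) (A ≟ᴹ B)
          (map-select-injective {A = A} {B} S≢ eS eA eB) (cong (map (select S))))

length-zipWith-∧ : ∀ {N} {α β : List Bool} → length α ≡ N → length β ≡ N → length (zipWith _∧_ α β) ≡ N
length-zipWith-∧ {α = α} {β} eα eβ = trans (length-zipWith _∧_ α β) (trans (cong₂ _⊓_ eα eβ) (⊓-idem _))

meetRows-Matrix : ∀ {N} A B → Matrix N A → Matrix N B → Matrix N (meetRows A B)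
meetRows-Matrix A B eA eB =
  filterB-All or (All-pairwise (zipWith _∧_) A B (λ {α} {β} α∈ β∈ →
    length-zipWith-∧ {α = α} {β} (All.lookup eA α∈) (All.lookup eB β∈)))

meet-map-select : ∀ S A B → AllPairs _≢_ S → Matrix (length S) A → Matrix (length S) B →
                  meet (map (select S) A) (map (select S) B) ≡ map (select S) (meetRows A B)
meet-map-select S A B S≢ eA eB = filterB-pairwise-map (select S) A B
  (λ {α} {β} _ _ → select-inter S α β S≢)
  (λ {α} {β} α∈ β∈ → nonEmpty-select S _ (length-zipWith-∧ {α = α} {β} (All.lookup eA α∈) (All.lookup eB β∈)))

-- Words and the ordered set partitions they encode

count : ℕ → List ℕ → ℕ
count i u = sum (map (λ j → if j ≡ᵇ i then 1 else 0) u)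

counts : List ℕ → List ℕ
counts u = map (λ i → count i u) (upTo (nblocks u))

letters<nblocks : ∀ u → All (_< nblocks u) u
letters<nblocks []      = []
letters<nblocks (x ∷ u) = All.tabulate (λ j∈ → s≤s (∈-maxL (x ∷ u) j∈))

count-∉ : ∀ {i} u → i ∉ u → count i u ≡ 0
count-∉     []      _   = refl
count-∉ {i} (j ∷ u) i∉u rewrite ≢⇒≡ᵇ-false {j} {i} (i∉u ∘ here ∘ sym) = count-∉ u (i∉u ∘ there)

count-unique : ∀ {i} u → AllPairs _≢_ u → i ∈ u → count i u ≡ 1
count-unique {i} (i ∷ u) (i≢u ∷ _)  (here refl) rewrite ≡ᵇ-refl i =
  cong suc (count-∉ u (λ i∈ → All.lookup i≢u i∈ refl))
count-unique {i} (j ∷ u) (j≢u ∷ u≢) (there i∈) rewrite ≢⇒≡ᵇ-false (λ j≡i → All.lookup j≢u i∈ j≡i) =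
  count-unique u u≢ i∈

count-upTo : ∀ {i} n → i < n → count i (upTo n) ≡ 1
count-upTo n i<n = count-unique (upTo n) (upTo-distinct n) (∈-upTo⁺ i<n)

sum-counts : ∀ u → sum (counts u) ≡ length u
sum-counts u = go u (letters<nblocks u)
  where
  open Sums ℕ.+-0-commutativeMonoid
  open ≡-Reasoning
  L = upTo (nblocks u)
  go : ∀ v → All (_< nblocks u) v → sum (map (λ i → count i v) L) ≡ length v
  go []      _           = Σ-zero L (λ _ → refl)
  go (a ∷ v) (a<b ∷ v<b) = begin
      sum (map (λ i → (if a ≡ᵇ i then 1 else 0) ℕ.+ count i v) L)
    ≡⟨ Σ-∙ _ _ L ⟩
      sum (map (λ i → if a ≡ᵇ i then 1 else 0) L) ℕ.+ sum (map (λ i → count i v) L)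
    ≡⟨ cong₂ ℕ._+_ (Σ-cong L (λ i → cong (λ b → if b then 1 else 0) (≡ᵇ-sym a i))) (go v v<b) ⟩
      count a L ℕ.+ length v
    ≡⟨ cong (ℕ._+ length v) (count-upTo (nblocks u) a<b) ⟩
      suc (length v)
    ∎

pick-select : ∀ S u i → pick S u i ≡ select S (indicator u i)
pick-select []      u       i = refl
pick-select (s ∷ S) []      i = refl
pick-select (s ∷ S) (j ∷ u) i with j ≡ᵇ i
... | true  = cong (s ∷_) (pick-select S u i)
... | false = pick-select S u i

blocks-select : ∀ S u → blocks S u ≡ map (select S) (indicators u)
blocks-select S u = trans (map-cong (pick-select S u) (upTo (nblocks u))) (map-∘ (upTo (nblocks u)))

indicators-Matrix : ∀ {N} u → length u ≡ N → Matrix N (indicators u)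
indicators-Matrix u lu = All.map⁺ (All.tabulate (λ {i} _ → trans (length-map (_≡ᵇ i) u) lu))

length-pick : ∀ S u i → length S ≡ length u → length (pick S u i) ≡ count i u
length-pick []      []      i _ = refl
length-pick (s ∷ S) (j ∷ u) i e with j ≡ᵇ i
... | true  = cong suc (length-pick S u i (suc-injective e))
... | false = length-pick S u i (suc-injective e)

shape-blocks : ∀ S u → length S ≡ length u → map length (blocks S u) ≡ counts u
shape-blocks S u e = trans (sym (map-∘ (upTo (nblocks u)))) (map-cong (λ i → length-pick S u i e) (upTo (nblocks u)))

size-blocks : ∀ S u → length S ≡ length u → sum (map length (blocks S u)) ≡ length S
size-blocks S u e = trans (cong sum (shape-blocks S u e)) (trans (sum-counts u) (sym e))

pick-∈ : ∀ {x} S u i → x ∈ pick S u i → x ∈ S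
pick-∈ S u i x∈ = select-∈ (indicator u i) (subst (_ ∈_) (pick-select S u i) x∈)

nonEmpty-pick : ∀ S u i → length S ≡ length u → nonEmpty (pick S u i) ≡ memb i u
nonEmpty-pick S u i e = begin
    nonEmpty (pick S u i)                ≡⟨ cong nonEmpty (pick-select S u i) ⟩
    nonEmpty (select S (indicator u i))  ≡⟨ nonEmpty-select S (indicator u i) (trans (length-map _ u) (sym e)) ⟩
    or (map (_≡ᵇ i) u)                   ≡⟨ cong or (map-cong (λ j → ≡ᵇ-sym j i) u) ⟩
    memb i u                             ∎
  where open ≡-Reasoning

pick-disjoint : ∀ {x} S u i j → AllPairs _≢_ S → x ∈ pick S u i → x ∈ pick S u j → i ≡ j
pick-disjoint (s ∷ S) (a ∷ u) i j (s≢ ∷ S≢) x∈i x∈j with a ≡ᵇ i in a≟i | a ≡ᵇ j in a≟j | x∈i | x∈j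
... | true  | true  | _           | _           = trans (sym (≡ᵇ-true⇒≡ {a} a≟i)) (≡ᵇ-true⇒≡ {a} a≟j)
... | false | false | x∈i′        | x∈j′        = pick-disjoint S u i j S≢ x∈i′ x∈j′
... | true  | false | here refl   | x∈j′        = ⊥-elim (All.lookup s≢ (pick-∈ S u j x∈j′) refl)
... | true  | false | there x∈i′  | x∈j′        = pick-disjoint S u i j S≢ x∈i′ x∈j′
... | false | true  | x∈i′        | here refl   = ⊥-elim (All.lookup s≢ (pick-∈ S u i x∈i′) refl)
... | false | true  | x∈i′        | there x∈j′  = pick-disjoint S u i j S≢ x∈i′ x∈j′

valid-blocks : ∀ S u → AllPairs _<_ S → All (0 <_) S → length S ≡ length u → surjW u ≡ true →
               valid (blocks S u) ≡ true
valid-blocks S u S< S⁺ e onto = ∧-true⁺ (All⇒all-true validBlock blocksValid) (AllPairs⇒nodup disjoint)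
  where
  increasing-positive : ∀ i → AllPairs _<_ (pick S u i) × All (0 <_) (pick S u i)
  increasing-positive i rewrite pick-select S u i = select-AllPairs (indicator u i) S< , select-All (indicator u i) S⁺

  blockValid : ∀ {i} → memb i u ≡ true → validBlock (pick S u i) ≡ true
  blockValid {i} i∈u = ∧-true⁺ (trans (nonEmpty-pick S u i e) i∈u)
    (∧-true⁺ (AllPairs⇒strictInc (proj₁ (increasing-positive i)))
             (All⇒all-true _ (All.map <⇒<ᵇ-true (proj₂ (increasing-positive i)))))

  blocksValid : All (λ b → validBlock b ≡ true) (blocks S u)
  blocksValid = All.map⁺ (All.map blockValid (all-true⇒All _ (upTo (nblocks u)) onto))

  apart : ∀ {i j} → i < j → All (λ x → All (x ≢_) (pick S u j)) (pick S u i)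
  apart {i} {j} i<j = All.tabulate (λ x∈i → All.tabulate (λ y∈j x≡y →
    <⇒≢ i<j (pick-disjoint S u i j (AllPairs.map <⇒≢ S<) x∈i (subst (_∈ pick S u j) (sym x≡y) y∈j))))

  disjoint : AllPairs _≢_ (concat (blocks S u))
  disjoint = AllPairs.concat⁺ (All.map⁺ (All.tabulate (λ {i} _ → AllPairs.map <⇒≢ (proj₁ (increasing-positive i)))))
                              (AllPairs.map⁺ (AllPairs.map apart (upTo-increasing (nblocks u))))

pick-cover : ∀ {x} S u → length S ≡ length u → x ∈ S → Σ ℕ (λ j → j ∈ u × x ∈ pick S u j)
pick-cover (s ∷ S) (a ∷ u) e (here refl) = a , here refl , s∈a
  where
  s∈a : s ∈ pick (s ∷ S) (a ∷ u) a
  s∈a rewrite ≡ᵇ-refl a = here refl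
pick-cover (s ∷ S) (a ∷ u) e (there x∈) with pick-cover S u (suc-injective e) x∈
... | j , j∈u , x∈j = j , there j∈u , extend x∈j
  where
  extend : _ ∈ pick S u j → _ ∈ pick (s ∷ S) (a ∷ u) j
  extend x∈j with a ≡ᵇ j
  ... | true  = there x∈j
  ... | false = x∈j

support-blocks : ∀ S u → AllPairs _<_ S → length S ≡ length u → support (blocks S u) ≡ S
support-blocks S u S< e =
  trans (sortedElements-cong (concat (blocks S u)) S sameElements) (increasing⇒sortedElements≡ S S<)
  where
  sameElements : ∀ x → memb x (concat (blocks S u)) ≡ memb x S
  sameElements x = memb-cong (concat (blocks S u)) S toS fromS
    where
    toS : x ∈ concat (blocks S u) → x ∈ S
    toS x∈ with ∈-concat⁻′ (blocks S u) x∈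
    ... | b , x∈b , b∈ with ∈-map⁻ (pick S u) b∈
    ...   | i , _ , refl = pick-∈ S u i x∈b
    fromS : x ∈ S → x ∈ concat (blocks S u)
    fromS x∈ with pick-cover S u e x∈
    ... | j , j∈u , x∈j = ∈-concat⁺′ x∈j (∈-map⁺ (pick S u) (∈-upTo⁺ (All.lookup (letters<nblocks u) j∈u)))

eqLL-meet-blocks : ∀ S u v w → AllPairs _≢_ S → length u ≡ length S → length v ≡ length S → length w ≡ length S →
                   eqLL (meet (blocks S u) (blocks S v)) (blocks S w)
                   ≡ does (meetRows (indicators u) (indicators v) ≟ᴹ indicators w)
eqLL-meet-blocks S u v w S≢ lu lv lw = begin
    eqLL (meet (blocks S u) (blocks S v)) (blocks S w)
  ≡⟨ cong₂ eqLL (cong₂ meet (blocks-select S u) (blocks-select S v)) (blocks-select S w) ⟩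
    eqLL (meet (map (select S) (indicators u)) (map (select S) (indicators v))) (map (select S) (indicators w))
  ≡⟨ cong (λ m → eqLL m (map (select S) (indicators w))) (meet-map-select S _ _ S≢ Mu Mv) ⟩
    eqLL (map (select S) (meetRows (indicators u) (indicators v))) (map (select S) (indicators w))
  ≡⟨ eqLL-map-select (meetRows (indicators u) (indicators v)) (indicators w) S≢ refl (meetRows-Matrix _ _ Mu Mv)
                     (indicators-Matrix w lw) ⟩
    does (meetRows (indicators u) (indicators v) ≟ᴹ indicators w)
  ∎
  where
  open ≡-Reasoning
  Mu = indicators-Matrix u lu
  Mv = indicators-Matrix v lv

words-length : ∀ m r → All (λ u → length u ≡ m) (words m r)
words-length zero    r = refl ∷ []
words-length (suc m) r = All.concat⁺ (All.map⁺ (All.tabulate {xs = upTo r} (λ {i} _ →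
                           All.map⁺ {f = i ∷_} (All.map (cong suc) (words-length m r)))))

All-setComps : ∀ {p} {P : Symbol → Set p} S → (∀ u → length u ≡ length S → surjW u ≡ true → P (blocks S u)) →
               All P (setComps S)
All-setComps S P-blocks = All.map⁺ (All.map (λ { (lu , onto) → P-blocks _ lu onto })
                                            (All-filterB⁺ surjW (words-length (length S) (length S))))

-- The word of a symbol

blockIndex : ℕ → Symbol → ℕ
blockIndex x []      = 0
blockIndex x (b ∷ s) = if memb x b then 0 else suc (blockIndex x s)

nth-⊆-concat : ∀ {y} (s : Symbol) i → y ∈ nth [] s i → y ∈ concat s
nth-⊆-concat (b ∷ s) zero    y∈ = ∈-++⁺ˡ y∈
nth-⊆-concat (b ∷ s) (suc i) y∈ = ∈-++⁺ʳ b (nth-⊆-concat s i y∈)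

blockIndex-≡ᵇ : ∀ {x} (s : Symbol) → x ∈ concat s → AllPairs _≢_ (concat s) →
                ∀ i → (blockIndex x s ≡ᵇ i) ≡ memb x (nth [] s i)
blockIndex-≡ᵇ {x} (b ∷ s) x∈ s≢ i with memb x b in x∈?b
blockIndex-≡ᵇ {x} (b ∷ s) x∈ s≢ zero    | true  = sym x∈?b
blockIndex-≡ᵇ {x} (b ∷ s) x∈ s≢ (suc i) | true  = sym (∉⇒memb-false (nth [] s i) notLater)
  where
  notLater : x ∉ nth [] s i
  notLater x∈i = All.lookup (All.lookup (proj₁ (AllPairs-++⁻ b s≢)) (memb-true⇒∈ b x∈?b)) (nth-⊆-concat s i x∈i) refl
blockIndex-≡ᵇ {x} (b ∷ s) x∈ s≢ zero    | false = sym x∈?b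
blockIndex-≡ᵇ {x} (b ∷ s) x∈ s≢ (suc i) | false with ∈-++⁻ b x∈
... | inj₁ x∈b = ⊥-elim (memb-false⇒∉ b x∈?b x∈b)
... | inj₂ x∈s = blockIndex-≡ᵇ s x∈s (proj₂ (AllPairs-++⁻ b s≢)) i

blockIndex-< : ∀ {x} (s : Symbol) → x ∈ concat s → blockIndex x s < length s
blockIndex-< {x} (b ∷ s) x∈ with memb x b in x∈?b
... | true  = s≤s z≤n
... | false with ∈-++⁻ b x∈
...   | inj₁ x∈b = ⊥-elim (memb-false⇒∉ b x∈?b x∈b)
...   | inj₂ x∈s = s≤s (blockIndex-< s x∈s)

validBlock⇒ : ∀ b → validBlock b ≡ true → nonEmpty b ≡ true × AllPairs _<_ b × All (0 <_) b
validBlock⇒ b e with ∧-true⁻ {nonEmpty b} e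
... | nonEmpty-b , rest with ∧-true⁻ {strictInc b} rest
...   | inc , pos = nonEmpty-b , strictInc⇒AllPairs b inc , All.map <ᵇ-true⇒< (all-true⇒All _ b pos)

nonEmpty⇒∈ : ∀ {b} → nonEmpty b ≡ true → Σ ℕ (_∈ b)
nonEmpty⇒∈ {y ∷ _} _ = y , here refl

pick-map : ∀ (f : ℕ → ℕ) S i → pick S (map f S) i ≡ filterB (λ x → f x ≡ᵇ i) S
pick-map f []      i = refl
pick-map f (x ∷ S) i with f x ≡ᵇ i
... | true  = cong (x ∷_) (pick-map f S i)
... | false = pick-map f S i

nblocks-exact : ∀ {k} w → All (_< k) w → (∀ {i} → i < k → i ∈ w) → nblocks w ≡ k
nblocks-exact {zero}  []      _        _    = refl
nblocks-exact {zero}  (x ∷ w) (() ∷ _) _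
nblocks-exact {suc k} []      _        hits with () ← hits {k} ≤-refl
nblocks-exact {suc k} (x ∷ w) w<k      hits =
  cong suc (≤-antisym (maxL-lub (x ∷ w) (All.map ℕ.≤-pred w<k)) (∈-maxL (x ∷ w) (hits ≤-refl)))

module WordOf (s : Symbol) (valid-s : valid s ≡ true) where

  blocksValid : All (λ b → validBlock b ≡ true) s
  blocksValid = all-true⇒All validBlock s (proj₁ (∧-true⁻ {all validBlock s} valid-s))

  distinct : AllPairs _≢_ (concat s)
  distinct = nodup⇒AllPairs (concat s) (proj₂ (∧-true⁻ {all validBlock s} valid-s))

  S : List ℕ
  S = support s

  w : List ℕ
  w = map (λ x → blockIndex x s) S

  S-increasing : AllPairs _<_ S
  S-increasing = sortedElements-increasing (concat s)

  S-positive : All (0 <_) S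
  S-positive = All.tabulate (λ x∈S → All.lookup positive (∈-sortedElements⁻ (concat s) x∈S))
    where
    positive : All (0 <_) (concat s)
    positive = All.concat⁺ (All.map (λ {b} e → proj₂ (proj₂ (validBlock⇒ b e))) blocksValid)

  shape-positive : All (0 <_) (map length s)
  shape-positive = All.map⁺ (All.map (λ {b} e → nonEmpty-length b (proj₁ (validBlock⇒ b e))) blocksValid)
    where
    nonEmpty-length : ∀ b → nonEmpty b ≡ true → 0 < length b
    nonEmpty-length (_ ∷ _) _ = s≤s z≤n

  length-w : length S ≡ length w
  length-w = sym (length-map _ S)

  private
    block : ∀ {i} → i < length s → validBlock (nth [] s i) ≡ true
    block i<s = All.lookup blocksValid (nth-∈ s i<s)

    pick-w : ∀ {i} → i < length s → pick S w i ≡ nth [] s i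
    pick-w {i} i<s = begin
        pick S w i                               ≡⟨ pick-map _ S i ⟩
        filterB (λ x → blockIndex x s ≡ᵇ i) S    ≡⟨ filterB-cong (All.tabulate (λ x∈S →
                                                      blockIndex-≡ᵇ s (∈-sortedElements⁻ (concat s) x∈S) distinct i)) ⟩
        filterB (λ x → memb x (nth [] s i)) S    ≡⟨ filterB-memb-⊆ S bᵢ-increasing S-increasing bᵢ⊆S ⟩
        nth [] s i                               ∎
      where
      open ≡-Reasoning
      bᵢ-increasing = proj₁ (proj₂ (validBlock⇒ _ (block i<s)))
      bᵢ⊆S = All.tabulate (∈-sortedElements⁺ (concat s) ∘ nth-⊆-concat s i)

    hit : ∀ {i} → i < length s → i ∈ w
    hit {i} i<s with nonEmpty⇒∈ (proj₁ (validBlock⇒ (nth [] s i) (block i<s)))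
    ... | y , y∈bᵢ = subst (_∈ w) index (∈-map⁺ (λ x → blockIndex x s) (∈-sortedElements⁺ (concat s) y∈s))
      where
      y∈s : y ∈ concat s
      y∈s = nth-⊆-concat s i y∈bᵢ
      index : blockIndex y s ≡ i
      index = ≡ᵇ-true⇒≡ (trans (blockIndex-≡ᵇ s y∈s distinct i) (∈⇒memb-true y∈bᵢ))

    nblocks-w : nblocks w ≡ length s
    nblocks-w = nblocks-exact w (All.map⁺ (All.tabulate (blockIndex-< s ∘ ∈-sortedElements⁻ (concat s)))) hit

  blocks-w : blocks S w ≡ s
  blocks-w rewrite nblocks-w = map-upTo-nth s (pick S w) pick-w

  surjW-w : surjW w ≡ true
  surjW-w rewrite nblocks-w = All⇒all-true _ (All.tabulate (∈⇒memb-true ∘ hit ∘ ∈-upTo⁻))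

  shape-s : map length s ≡ counts w
  shape-s = trans (cong (map length) (sym blocks-w)) (shape-blocks S w length-w)

  size-s : sum (map length s) ≡ length S
  size-s = trans (cong (sum ∘ map length) (sym blocks-w)) (size-blocks S w length-w)

-- Permuting the positions of words

swapAt : ∀ {A : Set} → ℕ → List A → List A
swapAt zero    (a ∷ b ∷ l) = b ∷ a ∷ l
swapAt (suc k) (a ∷ l)     = a ∷ swapAt k l
swapAt _       l           = l

module _ {A : Set} where

  swapAt-involutive : ∀ k (l : List A) → swapAt k (swapAt k l) ≡ l
  swapAt-involutive zero    []          = refl
  swapAt-involutive zero    (a ∷ [])    = refl
  swapAt-involutive zero    (a ∷ b ∷ l) = refl
  swapAt-involutive (suc k) []          = refl
  swapAt-involutive (suc k) (a ∷ l)     = cong (a ∷_) (swapAt-involutive k l)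

  swapAt-map : ∀ {B : Set} (f : A → B) k l → map f (swapAt k l) ≡ swapAt k (map f l)
  swapAt-map f zero    []          = refl
  swapAt-map f zero    (a ∷ [])    = refl
  swapAt-map f zero    (a ∷ b ∷ l) = refl
  swapAt-map f (suc k) []          = refl
  swapAt-map f (suc k) (a ∷ l)     = cong (f a ∷_) (swapAt-map f k l)

  swapAt-foldr : ∀ {C : Set} (_∙_ : A → C → C) e → (∀ a b c → a ∙ (b ∙ c) ≡ b ∙ (a ∙ c)) →
                 ∀ k l → foldr _∙_ e (swapAt k l) ≡ foldr _∙_ e l
  swapAt-foldr _∙_ e comm zero    []          = refl
  swapAt-foldr _∙_ e comm zero    (a ∷ [])    = refl
  swapAt-foldr _∙_ e comm zero    (a ∷ b ∷ l) = comm b a _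
  swapAt-foldr _∙_ e comm (suc k) []          = refl
  swapAt-foldr _∙_ e comm (suc k) (a ∷ l)     = cong (a ∙_) (swapAt-foldr _∙_ e comm k l)

  swapAt-zipWith : ∀ {B C : Set} (f : A → B → C) k as bs → length as ≡ length bs →
                   zipWith f (swapAt k as) (swapAt k bs) ≡ swapAt k (zipWith f as bs)
  swapAt-zipWith f zero    []           []           _ = refl
  swapAt-zipWith f zero    (a ∷ [])     (b ∷ [])     _ = refl
  swapAt-zipWith f zero    (a ∷ a′ ∷ as) (b ∷ b′ ∷ bs) _ = refl
  swapAt-zipWith f (suc k) []           []           _ = refl
  swapAt-zipWith f (suc k) (a ∷ as)     (b ∷ bs)     e = cong (f a b ∷_) (swapAt-zipWith f k as bs (suc-injective e))

swapAt-or : ∀ k m → or (swapAt k m) ≡ or m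
swapAt-or = swapAt-foldr _∨_ false (x∙yz≈y∙xz (CommutativeMonoid.commutativeSemigroup Bool.∨-commutativeMonoid))

swapAt-memb : ∀ x k l → memb x (swapAt k l) ≡ memb x l
swapAt-memb x k l = trans (cong or (swapAt-map (x ≡ᵇ_) k l)) (swapAt-or k (map (x ≡ᵇ_) l))

swapAt-maxL : ∀ k l → maxL (swapAt k l) ≡ maxL l
swapAt-maxL k l = maxL-memb-cong (swapAt k l) l (λ x → swapAt-memb x k l)

swapAt-nblocks : ∀ k u → nblocks (swapAt k u) ≡ nblocks u
swapAt-nblocks zero    []          = refl
swapAt-nblocks zero    (a ∷ [])    = refl
swapAt-nblocks zero    (a ∷ b ∷ l) = cong suc (swapAt-maxL zero (a ∷ b ∷ l))
swapAt-nblocks (suc k) []          = refl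
swapAt-nblocks (suc k) (a ∷ l)     = cong suc (swapAt-maxL (suc k) (a ∷ l))

swapAt-count : ∀ i k u → count i (swapAt k u) ≡ count i u
swapAt-count i k u =
  trans (cong sum (swapAt-map _ k u)) (swapAt-foldr ℕ._+_ 0 (x∙yz≈y∙xz ℕ.+-commutativeSemigroup) k _)

swapAt-surjW : ∀ k u → surjW (swapAt k u) ≡ surjW u
swapAt-surjW k u rewrite swapAt-nblocks k u = all-cong (upTo (nblocks u)) (λ i → swapAt-memb i k u)

swapAt-counts : ∀ k u → counts (swapAt k u) ≡ counts u
swapAt-counts k u rewrite swapAt-nblocks k u = map-cong (λ i → swapAt-count i k u) (upTo (nblocks u))

swapAt-indicators : ∀ k u → indicators (swapAt k u) ≡ map (swapAt k) (indicators u)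
swapAt-indicators k u rewrite swapAt-nblocks k u =
  trans (map-cong (λ i → swapAt-map (_≡ᵇ i) k u) (upTo (nblocks u))) (map-∘ (upTo (nblocks u)))

swapAt-meetRows : ∀ {N} k A B → Matrix N A → Matrix N B →
                  meetRows (map (swapAt k) A) (map (swapAt k) B) ≡ map (swapAt k) (meetRows A B)
swapAt-meetRows k A B eA eB = filterB-pairwise-map (swapAt k) A B
  (λ {α} {β} α∈ β∈ → swapAt-zipWith _∧_ k α β (trans (All.lookup eA α∈) (sym (All.lookup eB β∈))))
  (λ _ _ → swapAt-or k _)

does-swapAt : ∀ k A B → does (map (swapAt k) A ≟ᴹ map (swapAt k) B) ≡ does (A ≟ᴹ B)
does-swapAt k A B = does-⇔ (map (swapAt k) A ≟ᴹ map (swapAt k) B) (A ≟ᴹ B) unswap (cong (map (swapAt k)))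
  where
  unswap : map (swapAt k) A ≡ map (swapAt k) B → A ≡ B
  unswap e = trans (sym (twice A)) (trans (cong (map (swapAt k)) e) (twice B))
    where
    twice : ∀ M → map (swapAt k) (map (swapAt k) M) ≡ M
    twice M = trans (sym (map-∘ M)) (trans (map-cong (swapAt-involutive k) M) (map-id M))

module _ {c ℓ : Level} {A : Set} (S : Setoid c ℓ) where
  open Setoid S using (Carrier; _≈_) renaming (refl to ≈-refl; sym to ≈-sym; trans to ≈-trans)

  swapAt-invariant⇒↭-invariant : ∀ (F : List A → Carrier) → (∀ k w → F (swapAt k w) ≈ F w) →
                                 ∀ {w w′} → w ↭ w′ → F w ≈ F w′
  swapAt-invariant⇒↭-invariant F inv ↭.refl           = ≈-refl
  swapAt-invariant⇒↭-invariant F inv (↭.prep x w↭w′)  =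
    swapAt-invariant⇒↭-invariant (F ∘ (x ∷_)) (λ k w → inv (suc k) (x ∷ w)) w↭w′
  swapAt-invariant⇒↭-invariant F inv {_} {y ∷ x ∷ w′} (↭.swap x y w↭w′) =
    ≈-trans (swapAt-invariant⇒↭-invariant (λ w → F (x ∷ y ∷ w)) (λ k w → inv (suc (suc k)) (x ∷ y ∷ w)) w↭w′)
          (≈-sym (inv zero (x ∷ y ∷ w′)))
  swapAt-invariant⇒↭-invariant F inv (↭.trans w↭w′ w′↭w″) =
    ≈-trans (swapAt-invariant⇒↭-invariant F inv w↭w′) (swapAt-invariant⇒↭-invariant F inv w′↭w″)

sortedWord : (ℕ → ℕ) → List ℕ → List ℕ
sortedWord c = concatMap (λ i → replicate (c i) i)

canonical : List ℕ → List ℕ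
canonical t = sortedWord (nth 0 t) (upTo (length t))

sortedWord-cong : ∀ {c c′ : ℕ → ℕ} L → All (λ i → c i ≡ c′ i) L → sortedWord c L ≡ sortedWord c′ L
sortedWord-cong []      []       = refl
sortedWord-cong (i ∷ L) (e ∷ es) = cong₂ _++_ (cong (λ k → replicate k i) e) (sortedWord-cong L es)

sortedWord-insert : ∀ {a} (c : ℕ → ℕ) L → AllPairs _≢_ L → a ∈ L →
                    sortedWord (λ i → (if a ≡ᵇ i then 1 else 0) ℕ.+ c i) L ↭ a ∷ sortedWord c L
sortedWord-insert {a} c (a ∷ L) (a≢L ∷ _) (here refl) rewrite ≡ᵇ-refl a =
  ↭-prep a (↭-reflexive (cong (replicate (c a) a ++_) (sortedWord-cong L (All.map unchanged a≢L))))
  where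
  unchanged : ∀ {i} → a ≢ i → (if a ≡ᵇ i then 1 else 0) ℕ.+ c i ≡ c i
  unchanged a≢i rewrite ≢⇒≡ᵇ-false a≢i = refl
sortedWord-insert {a} c (j ∷ L) (j≢L ∷ L≢) (there a∈L)
  rewrite ≢⇒≡ᵇ-false {a} {j} (λ { refl → All.lookup j≢L a∈L refl }) =
  ↭-trans (++⁺ˡ (replicate (c j) j) (sortedWord-insert c L L≢ a∈L)) (shift a (replicate (c j) j) (sortedWord c L))

↭-sortedWord : ∀ {B} w → All (_< B) w → w ↭ sortedWord (λ i → count i w) (upTo B)
↭-sortedWord {B} []      _           = ↭-reflexive (sym (sortedWord-empty (upTo B)))
  where
  sortedWord-empty : ∀ L → sortedWord (λ _ → 0) L ≡ []
  sortedWord-empty []      = refl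
  sortedWord-empty (_ ∷ L) = sortedWord-empty L
↭-sortedWord {B} (a ∷ w) (a<B ∷ w<B) = ↭-trans (↭-prep a (↭-sortedWord w w<B))
  (↭-sym (sortedWord-insert (λ i → count i w) (upTo B) (upTo-distinct B) (∈-upTo⁺ a<B)))

↭-canonical-counts : ∀ w → w ↭ canonical (counts w)
↭-canonical-counts w = subst (w ↭_) sortedWord-counts (↭-sortedWord w (letters<nblocks w))
  where
  B = nblocks w
  sortedWord-counts : sortedWord (λ i → count i w) (upTo B) ≡ canonical (counts w)
  sortedWord-counts rewrite length-map (λ i → count i w) (upTo B) | length-upTo B =
    sortedWord-cong (upTo B) (All.tabulate (λ i∈ → sym (nth-map-upTo (λ i → count i w) B (∈-upTo⁻ i∈))))

module WordSums {c ℓ : Level} (M : CommutativeMonoid c ℓ) where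
  open CommutativeMonoid M
    using (Carrier; _≈_; setoid) renaming (refl to ≈-refl; sym to ≈-sym; trans to ≈-trans; reflexive to ≈-reflexive)
  open Sums M
  open import Relation.Binary.Reasoning.Setoid setoid

  Σ-words : ℕ → ℕ → (List ℕ → Carrier) → Carrier
  Σ-words m r f = Σ[ map f (words m r) ]

  Σ-words-cong : ∀ m r {f g : List ℕ → Carrier} → (∀ {u} → length u ≡ m → f u ≈ g u) → Σ-words m r f ≈ Σ-words m r g
  Σ-words-cong m r f≈g = Σ-cong-All (All.map f≈g (words-length m r))

  Σ-words-suc : ∀ m r f → Σ-words (suc m) r f ≈ Σ[ map (λ i → Σ-words m r (f ∘ (i ∷_))) (upTo r) ]
  Σ-words-suc m r f = ≈-trans (Σ-map-concatMap f (λ i → map (i ∷_) (words m r)) (upTo r))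
    (Σ-cong (upTo r) (λ i → ≈-reflexive (cong Σ[_] (sym (map-∘ (words m r))))))

  Σ-words-swapAt : ∀ m r k f → Σ-words m r (f ∘ swapAt k) ≈ Σ-words m r f
  Σ-words-swapAt zero          r zero    f = ≈-refl
  Σ-words-swapAt zero          r (suc k) f = ≈-refl
  Σ-words-swapAt (suc zero)    r zero    f = ≈-trans (Σ-words-suc zero r _) (≈-sym (Σ-words-suc zero r f))
  Σ-words-swapAt (suc (suc m)) r zero    f = begin
      Σ-words (suc (suc m)) r (f ∘ swapAt zero)
    ≈⟨ Σ-words-suc (suc m) r _ ⟩
      Σ[ map (λ i → Σ-words (suc m) r (λ u → f (swapAt zero (i ∷ u)))) (upTo r) ]
    ≈⟨ Σ-cong (upTo r) (λ i → Σ-words-suc m r _) ⟩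
      Σ[ map (λ i → Σ[ map (λ j → Σ-words m r (λ u → f (j ∷ i ∷ u))) (upTo r) ]) (upTo r) ]
    ≈⟨ Σ-swap (λ i j → Σ-words m r (λ u → f (j ∷ i ∷ u))) (upTo r) (upTo r) ⟩
      Σ[ map (λ j → Σ[ map (λ i → Σ-words m r (λ u → f (j ∷ i ∷ u))) (upTo r) ]) (upTo r) ]
    ≈⟨ Σ-cong (upTo r) (λ j → ≈-sym (Σ-words-suc m r _)) ⟩
      Σ[ map (λ j → Σ-words (suc m) r (f ∘ (j ∷_))) (upTo r) ]
    ≈⟨ ≈-sym (Σ-words-suc (suc m) r f) ⟩
      Σ-words (suc (suc m)) r f
    ∎
  Σ-words-swapAt (suc m)       r (suc k) f = begin
      Σ-words (suc m) r (f ∘ swapAt (suc k))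
    ≈⟨ Σ-words-suc m r _ ⟩
      Σ[ map (λ i → Σ-words m r (λ u → f (i ∷ swapAt k u))) (upTo r) ]
    ≈⟨ Σ-cong (upTo r) (λ i → Σ-words-swapAt m r k (f ∘ (i ∷_))) ⟩
      Σ[ map (λ i → Σ-words m r (f ∘ (i ∷_))) (upTo r) ]
    ≈⟨ ≈-sym (Σ-words-suc m r f) ⟩
      Σ-words (suc m) r f
    ∎

-- Compositions of n into at most f parts; with f ≥ n these are all compositions of n.
boundedCompositions : ℕ → ℕ → List (List ℕ)
boundedCompositions f       zero    = [] ∷ []
boundedCompositions zero    (suc n) = []
boundedCompositions (suc f) (suc n) = concatMap (λ k → map (suc k ∷_) (boundedCompositions f (n ∸ k))) (upTo (suc n))

compositions : ℕ → List (List ℕ)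
compositions n = boundedCompositions n n

boundedCompositions-sound : ∀ f n → All (IsComposition n) (boundedCompositions f n)
boundedCompositions-sound f       zero    = ([] , refl) ∷ []
boundedCompositions-sound zero    (suc n) = []
boundedCompositions-sound (suc f) (suc n) = All.concat⁺ (All.map⁺ (All.tabulate (λ {k} k∈ →
  All.map⁺ (All.map (extend (ℕ.≤-pred (∈-upTo⁻ k∈))) (boundedCompositions-sound f (n ∸ k))))))
  where
  extend : ∀ {k γ} → k ≤ n → IsComposition (n ∸ k) γ → IsComposition (suc n) (suc k ∷ γ)
  extend {k} k≤n (γ⁺ , Σγ) = s≤s z≤n ∷ γ⁺ , cong suc (trans (cong (k ℕ.+_) Σγ) (ℕ.m+[n∸m]≡n k≤n))

<ᵇ-∧-≡ᵇ-∸ : ∀ j n m → (j <ᵇ suc n) ∧ (m ≡ᵇ n ∸ j) ≡ (suc j ℕ.+ m ≡ᵇ suc n)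
<ᵇ-∧-≡ᵇ-∸ zero    n       m = refl
<ᵇ-∧-≡ᵇ-∸ (suc j) zero    m = refl
<ᵇ-∧-≡ᵇ-∸ (suc j) (suc n) m = <ᵇ-∧-≡ᵇ-∸ j n m

module CompositionSums {c ℓ : Level} (M : CommutativeMonoid c ℓ) where
  open CommutativeMonoid M
    using (Carrier; _≈_; setoid; ε; identityʳ)
    renaming (refl to ≈-refl; sym to ≈-sym; trans to ≈-trans; reflexive to ≈-reflexive)
  open Sums M
  open import Relation.Binary.Reasoning.Setoid setoid

  Σ-boundedCompositions-suc : ∀ f n (G : List ℕ → Carrier) →
    Σ[ map G (boundedCompositions (suc f) (suc n)) ]
    ≈ Σ[ map (λ k → Σ[ map (G ∘ (suc k ∷_)) (boundedCompositions f (n ∸ k)) ]) (upTo (suc n)) ]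
  Σ-boundedCompositions-suc f n G =
    ≈-trans (Σ-map-concatMap G (λ k → map (suc k ∷_) (boundedCompositions f (n ∸ k))) (upTo (suc n)))
            (Σ-cong (upTo (suc n)) (λ k → ≈-reflexive (cong Σ[_] (sym (map-∘ (boundedCompositions f (n ∸ k)))))))

  Σ-boundedCompositions : ∀ f n t (g : List ℕ → Carrier) → n ≤ f → All (0 <_) t →
                          Σ[ map (λ γ → when (eqL t γ) (g γ)) (boundedCompositions f n) ] ≈ when (sum t ≡ᵇ n) (g t)
  Σ-boundedCompositions f       zero    []          g _         _        = identityʳ (g [])
  Σ-boundedCompositions f       zero    (suc j ∷ t) g _         _        = identityʳ ε
  Σ-boundedCompositions f       zero    (zero ∷ t)  g _         (() ∷ _)
  Σ-boundedCompositions (suc f) (suc n) []          g _         _        =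
    ≈-trans (Σ-boundedCompositions-suc f n _)
            (Σ-zero (upTo (suc n)) (λ k → Σ-zero (boundedCompositions f (n ∸ k)) (λ _ → ≈-refl)))
  Σ-boundedCompositions (suc f) (suc n) (suc j ∷ t) g (s≤s n≤f) (_ ∷ t⁺) = begin
      Σ[ map (λ γ → when (eqL (suc j ∷ t) γ) (g γ)) (boundedCompositions (suc f) (suc n)) ]
    ≈⟨ Σ-boundedCompositions-suc f n _ ⟩
      Σ[ map (λ k → Σ[ map (λ γ → when ((j ≡ᵇ k) ∧ eqL t γ) (g (suc k ∷ γ))) (C k) ]) (upTo (suc n)) ]
    ≈⟨ Σ-cong (upTo (suc n)) (λ k → ≈-trans (Σ-cong (C k) (λ γ → ≈-reflexive (when-∧ (j ≡ᵇ k) (eqL t γ) _)))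
                                           (≈-sym (Σ-when (j ≡ᵇ k) _ (C k)))) ⟩
      Σ[ map (λ k → when (j ≡ᵇ k) Σ[ map (λ γ → when (eqL t γ) (g (suc k ∷ γ))) (C k) ]) (upTo (suc n)) ]
    ≈⟨ Σ-cong (upTo (suc n)) (λ k → when-cong (j ≡ᵇ k)
         (Σ-boundedCompositions f (n ∸ k) t (g ∘ (suc k ∷_)) (≤-trans (ℕ.m∸n≤m n k) n≤f) t⁺)) ⟩
      Σ[ map (λ k → when (j ≡ᵇ k) (when (sum t ≡ᵇ n ∸ k) (g (suc k ∷ t)))) (upTo (suc n)) ]
    ≈⟨ Σ-upTo-when-≡ᵇ j (suc n) _ ⟩
      when (j <ᵇ suc n) (when (sum t ≡ᵇ n ∸ j) (g (suc j ∷ t)))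
    ≡⟨ trans (sym (when-∧ (j <ᵇ suc n) _ _)) (cong (λ b → when b (g (suc j ∷ t))) (<ᵇ-∧-≡ᵇ-∸ j n (sum t))) ⟩
      when (suc j ℕ.+ sum t ≡ᵇ suc n) (g (suc j ∷ t))
    ∎
    where
    C : ℕ → List (List ℕ)
    C k = boundedCompositions f (n ∸ k)

-- The algebra T̂

module Algebra-T̂ {c ℓ : Level} (R : CommutativeRing c ℓ) where
  open CommutativeRing R
    using ( Carrier; _≈_; setoid; 0#; 1#; _+_; _*_; +-cong; *-cong; +-identityˡ; *-identityʳ; zeroˡ; zeroʳ
          ; +-commutativeMonoid)
    renaming (refl to ≈-refl; sym to ≈-sym; trans to ≈-trans; reflexive to ≈-reflexive)
  open Construction R
  open Sums +-commutativeMonoid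
  open WordSums +-commutativeMonoid
  open CompositionSums +-commutativeMonoid
  open import Relation.Binary.Reasoning.Setoid setoid

  when-+ : ∀ b x y → when b (x + y) ≈ when b x + when b y
  when-+ true  x y = ≈-refl
  when-+ false x y = ≈-sym (+-identityˡ 0#)

  *-when : ∀ b r x → r * when b x ≈ when b (r * x)
  *-when true  r x = ≈-refl
  *-when false r x = zeroʳ r

  when-* : ∀ b x y → when b (x * y) ≈ when b x * when b y
  when-* true  x y = ≈-refl
  when-* false x y = ≈-sym (zeroˡ 0#)

  when-when : ∀ a b x → when a (when b x) ≡ when b (when a x)
  when-when true  b x = refl
  when-when false true  x = refl
  when-when false false x = refl

  when-cong-true : ∀ b {x y} → (b ≡ true → x ≈ y) → when b x ≈ when b y
  when-cong-true true  x≈y = x≈y refl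
  when-cong-true false _   = ≈-refl

  restrict-cong : ∀ S {f g} → f ≈̂ g → restrict S f ≈̂ restrict S g
  restrict-cong S f≈g s v = when-cong (eqL (support s) S) (f≈g s v)

  restrict-+̂ : ∀ S f g s → restrict S (f +̂ g) s ≈ (restrict S f +̂ restrict S g) s
  restrict-+̂ S f g s = when-+ (eqL (support s) S) (f s) (g s)

  restrict-·̂ : ∀ S r f s → restrict S (r ·̂ f) s ≈ (r ·̂ restrict S f) s
  restrict-·̂ S r f s = ≈-sym (*-when (eqL (support s) S) r (f s))

  restrict-lincomb : ∀ S e l s → restrict S (lincomb e l) s ≈ lincomb (restrict S ∘ e) l s
  restrict-lincomb S e []            s = ≈-reflexive (when-ε (eqL (support s) S))
  restrict-lincomb S e ((r , α) ∷ l) s = ≈-trans (when-+ (eqL (support s) S) _ _)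
    (+-cong (restrict-·̂ S r (e α) s) (restrict-lincomb S e l s))

  Σ-setComps : ∀ S (F : Symbol → Carrier) →
               Σ[ map F (setComps S) ] ≈ Σ-words (length S) (length S) (λ u → when (surjW u) (F (blocks S u)))
  Σ-setComps S F = ≈-trans (≈-reflexive (cong Σ[_] (sym (map-∘ (filterB surjW (words (length S) (length S)))))))
                           (Σ-filterB (F ∘ blocks S) surjW (words (length S) (length S)))

  ∘̂-as-double-sum : ∀ f g {S} s → support s ≡ S →
    (f ∘̂ g) s ≈ Σ[ map (λ a → Σ[ map (λ b → when (eqLL (meet a b) s) (f a * g b)) (setComps S) ]) (setComps S) ]
  ∘̂-as-double-sum f g s refl = Σ-concatMap _ (setComps (support s))

  setComps-support : ∀ s → All (λ a → support a ≡ support s) (setComps (support s))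
  setComps-support s = All-setComps (support s) (λ u lu _ →
    support-blocks (support s) u (sortedElements-increasing (concat s)) (sym lu))

  restrict-∘̂ : ∀ S f g s → restrict S (f ∘̂ g) s ≈ (restrict S f ∘̂ restrict S g) s
  restrict-∘̂ S f g s = begin
      when e ((f ∘̂ g) s)
    ≈⟨ when-cong e (∘̂-as-double-sum f g s refl) ⟩
      when e Σ[ map (λ a → Σ[ map (term f g a) SC ]) SC ]
    ≈⟨ Σ-when e _ SC ⟩
      Σ[ map (λ a → when e Σ[ map (term f g a) SC ]) SC ]
    ≈⟨ Σ-cong-All (All.map (λ a-supp → ≈-trans (Σ-when e _ SC)
                                                (Σ-cong-All (All.map (pointwise a-supp) (setComps-support s))))
                           (setComps-support s)) ⟩
      Σ[ map (λ a → Σ[ map (term (restrict S f) (restrict S g) a) SC ]) SC ]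
    ≈⟨ ≈-sym (∘̂-as-double-sum (restrict S f) (restrict S g) s refl) ⟩
      (restrict S f ∘̂ restrict S g) s
    ∎
    where
    e = eqL (support s) S
    SC = setComps (support s)
    term : That → That → Symbol → Symbol → Carrier
    term f g a b = when (eqLL (meet a b) s) (f a * g b)
    restrict-at : ∀ f {a} → support a ≡ support s → restrict S f a ≡ when e (f a)
    restrict-at f a-supp = cong (λ T → when (eqL T S) (f _)) a-supp
    pointwise : ∀ {a b} → support a ≡ support s → support b ≡ support s →
                when e (term f g a b) ≈ term (restrict S f) (restrict S g) a b
    pointwise {a} {b} a-supp b-supp = begin
        when e (when m (f a * g b))                ≡⟨ when-when e m _ ⟩
        when m (when e (f a * g b))                ≈⟨ when-cong m (when-* e (f a) (g b)) ⟩
        when m (when e (f a) * when e (g b))       ≡⟨ sym (cong₂ (λ x y → when m (x * y))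
                                                                 (restrict-at f a-supp) (restrict-at g b-supp)) ⟩
        when m (restrict S f a * restrict S g b)   ∎
      where m = eqLL (meet a b) s

  shape : Symbol → List ℕ
  shape = map length

  ShapeDetermined : That → Set (c ⊔ ℓ)
  ShapeDetermined f = Σ (List ℕ → Carrier) λ F → ∀ s → valid s ≡ true → f s ≈ F (shape s)

  VanishesOffSize : ℕ → That → Set ℓ
  VanishesOffSize n f = ∀ s → valid s ≡ true → sum (shape s) ≢ n → f s ≈ 0#

  AllCompositions : ℕ → List (Carrier × List ℕ) → Set c
  AllCompositions n = All (λ p → IsComposition n (proj₂ p))

  coefficient : List (Carrier × List ℕ) → List ℕ → Carrier
  coefficient l t = Σ[ map (λ p → proj₁ p * when (eqL t (proj₂ p)) 1#) l ]

  lincomb-one-valid : ∀ l a → valid a ≡ true → lincomb one l a ≡ coefficient l (shape a)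
  lincomb-one-valid []            a v = refl
  lincomb-one-valid ((r , α) ∷ l) a v rewrite v = cong (r * when (eqL (shape a) α) 1# +_) (lincomb-one-valid l a v)

  coefficient-off : ∀ {n} t {l} → AllCompositions n l → sum t ≢ n → coefficient l t ≈ 0#
  coefficient-off t []                                  _   = ≈-refl
  coefficient-off t {(r , α) ∷ l} ((_ , Σα) ∷ l-ok) off with eqL t α in t≟α
  ... | true  = ⊥-elim (off (trans (cong sum (eqL-true⇒≡ {t} {α} t≟α)) Σα))
  ... | false = ≈-trans (+-cong (zeroʳ r) (coefficient-off t l-ok off)) (+-identityˡ 0#)

  InD⇒ShapeDetermined : ∀ {n x} → InD n x → ShapeDetermined x
  InD⇒ShapeDetermined (l , _ , x≈) =
    coefficient l , λ s v → ≈-trans (x≈ s (from T-≡ v)) (≈-reflexive (lincomb-one-valid l s v))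

  InD⇒VanishesOffSize : ∀ {n x} → InD n x → VanishesOffSize n x
  InD⇒VanishesOffSize x∈D@(l , l-ok , _) s v off =
    ≈-trans (proj₂ (InD⇒ShapeDetermined x∈D) s v) (coefficient-off (shape s) l-ok off)

  onCompositions : (List ℕ → Carrier) → ℕ → List (Carrier × List ℕ)
  onCompositions F n = map (λ γ → (F γ , γ)) (compositions n)

  lincomb-compositions : ∀ n (F : List ℕ → Carrier) s → valid s ≡ true →
                         lincomb one (onCompositions F n) s ≈ when (sum (shape s) ≡ᵇ n) (F (shape s))
  lincomb-compositions n F s v = begin
      lincomb one (onCompositions F n) s
    ≡⟨ trans (lincomb-one-valid (onCompositions F n) s v) (cong Σ[_] (sym (map-∘ (compositions n)))) ⟩
      Σ[ map (λ γ → F γ * when (eqL t γ) 1#) (compositions n) ]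
    ≈⟨ Σ-cong (compositions n) (λ γ → ≈-trans (*-when (eqL t γ) (F γ) 1#)
                                              (when-cong (eqL t γ) (*-identityʳ (F γ)))) ⟩
      Σ[ map (λ γ → when (eqL t γ) (F γ)) (compositions n) ]
    ≈⟨ Σ-boundedCompositions n n t F ≤-refl (WordOf.shape-positive s v) ⟩
      when (sum t ≡ᵇ n) (F t)
    ∎
    where t = shape s

  ShapeDetermined⇒InD : ∀ {n z} → ShapeDetermined z → VanishesOffSize n z → InD n z
  ShapeDetermined⇒InD {n} {z} (F , z≈F) z-off = onCompositions F n , All.map⁺ (boundedCompositions-sound n n) , agree
    where
    agree : z ≈̂ lincomb one (onCompositions F n)
    agree s vT = ≈-sym (≈-trans (lincomb-compositions n F s v) (by-size (sum (shape s) ≡ᵇ n) refl))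
      where
      v = to T-≡ vT
      by-size : ∀ b → (sum (shape s) ≡ᵇ n) ≡ b → when b (F (shape s)) ≈ z s
      by-size true  _ = ≈-sym (z≈F s v)
      by-size false e = ≈-sym (z-off s v (≡ᵇ-false⇒≢ e))

  ∘̂-VanishesOffSize : ∀ {n x} y → VanishesOffSize n x → VanishesOffSize n (x ∘̂ y)
  ∘̂-VanishesOffSize {n} {x} y x-off s v off = ≈-trans (∘̂-as-double-sum x y s refl)
    (Σ-zero-All (All.map (λ xa≈0 → Σ-zero-All (All.tabulate {xs = setComps S} (λ _ → vanish xa≈0))) x-vanishes))
    where
    open WordOf s v
    vanish : ∀ {a b} → x a ≈ 0# → when (eqLL (meet a b) s) (x a * y b) ≈ 0#
    vanish {a} {b} xa≈0 = ≈-trans (when-cong (eqLL (meet a b) s) (≈-trans (*-cong xa≈0 ≈-refl) (zeroˡ (y b))))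
                                  (≈-reflexive (when-ε (eqLL (meet a b) s)))
    x-vanishes : All (λ a → x a ≈ 0#) (setComps S)
    x-vanishes = All-setComps S (λ u lu onto →
      x-off (blocks S u) (valid-blocks S u S-increasing S-positive (sym lu) onto)
            (λ size≡n → off (trans size-s (trans (sym (size-blocks S u (sym lu))) size≡n))))

  module Convolution (X Y : List ℕ → Carrier) where

    -- The (u, v)-summand of (x ∘̂ y) (blocks S w), expressed through positions only; this is what
    -- makes it invariant under permuting positions.
    term : List ℕ → List ℕ → List ℕ → Carrier
    term u v w = when (surjW u) (when (surjW v)
      (when (does (meetRows (indicators u) (indicators v) ≟ᴹ indicators w)) (X (counts u) * Y (counts v))))

    convolution : ℕ → List ℕ → Carrier
    convolution N w = Σ-words N N (λ u → Σ-words N N (λ v → term u v w))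

    term-swapAt : ∀ k u v w → length u ≡ length v → term (swapAt k u) (swapAt k v) (swapAt k w) ≡ term u v w
    term-swapAt k u v w lu≡lv
      rewrite swapAt-surjW k u | swapAt-surjW k v | swapAt-counts k u | swapAt-counts k v
            | swapAt-indicators k u | swapAt-indicators k v | swapAt-indicators k w
            | swapAt-meetRows k (indicators u) (indicators v) (indicators-Matrix u refl) (indicators-Matrix v (sym lu≡lv))
            | does-swapAt k (meetRows (indicators u) (indicators v)) (indicators w) = refl

    convolution-swapAt : ∀ N k w → convolution N (swapAt k w) ≈ convolution N w
    convolution-swapAt N k w = begin
        Σ-words N N (λ u → Σ-words N N (λ v → term u v (swapAt k w)))
      ≈⟨ ≈-sym (Σ-words-swapAt N N k _) ⟩
        Σ-words N N (λ u → Σ-words N N (λ v → term (swapAt k u) v (swapAt k w)))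
      ≈⟨ Σ-cong (words N N) (λ u → ≈-sym (Σ-words-swapAt N N k _)) ⟩
        Σ-words N N (λ u → Σ-words N N (λ v → term (swapAt k u) (swapAt k v) (swapAt k w)))
      ≈⟨ Σ-words-cong N N (λ lu → Σ-words-cong N N (λ lv → ≈-reflexive (term-swapAt k _ _ w (trans lu (sym lv))))) ⟩
        Σ-words N N (λ u → Σ-words N N (λ v → term u v w))
      ∎

    convolution-↭ : ∀ N {w w′} → w ↭ w′ → convolution N w ≈ convolution N w′
    convolution-↭ N = swapAt-invariant⇒↭-invariant setoid (convolution N) (convolution-swapAt N)

    module _ {x y : That} (x≈X : ∀ a → valid a ≡ true → x a ≈ X (shape a))
             (y≈Y : ∀ a → valid a ≡ true → y a ≈ Y (shape a))
             (S : List ℕ) (S-increasing : AllPairs _<_ S) (S-positive : All (0 <_) S) where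

      private
        N = length S

        value-blocks : ∀ {f : That} {F : List ℕ → Carrier} → (∀ a → valid a ≡ true → f a ≈ F (shape a)) →
                       ∀ u → length u ≡ N → surjW u ≡ true → f (blocks S u) ≈ F (counts u)
        value-blocks {f} {F} f≈F u lu onto =
          ≈-trans (f≈F (blocks S u) (valid-blocks S u S-increasing S-positive (sym lu) onto))
                  (≈-reflexive (cong F (shape-blocks S u (sym lu))))

        summand : List ℕ → Symbol → Symbol → Carrier
        summand w a b = when (eqLL (meet a b) (blocks S w)) (x a * y b)

        summand≈term : ∀ w → length w ≡ N → ∀ {u v} → length u ≡ N → length v ≡ N →
                       when (surjW u) (when (surjW v) (summand w (blocks S u) (blocks S v))) ≈ term u v w
        summand≈term w lw {u} {v} lu lv = when-cong-true (surjW u) λ onto-u → when-cong-true (surjW v) λ onto-v →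
          ≈-trans (≈-reflexive (cong (λ b → when b _) (eqLL-meet-blocks S u v w (AllPairs.map <⇒≢ S-increasing) lu lv lw)))
                  (when-cong _ (*-cong (value-blocks {F = X} x≈X u lu onto-u) (value-blocks {F = Y} y≈Y v lv onto-v)))

      ∘̂-blocks : ∀ w → length w ≡ N → (x ∘̂ y) (blocks S w) ≈ convolution N w
      ∘̂-blocks w lw = begin
          (x ∘̂ y) (blocks S w)
        ≈⟨ ∘̂-as-double-sum x y (blocks S w) (support-blocks S w S-increasing (sym lw)) ⟩
          Σ[ map (λ a → Σ[ map (summand w a) (setComps S) ]) (setComps S) ]
        ≈⟨ Σ-setComps S _ ⟩
          Σ-words N N (λ u → when (surjW u) Σ[ map (summand w (blocks S u)) (setComps S) ])
        ≈⟨ Σ-cong (words N N) (λ u → ≈-trans (when-cong (surjW u) (Σ-setComps S _)) (Σ-when (surjW u) _ (words N N))) ⟩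
          Σ-words N N (λ u → Σ-words N N (λ v → when (surjW u) (when (surjW v) (summand w (blocks S u) (blocks S v)))))
        ≈⟨ Σ-words-cong N N (λ {u} lu → Σ-words-cong N N (λ {v} → summand≈term w lw {u} {v} lu)) ⟩
          convolution N w
        ∎

  ∘̂-ShapeDetermined : ∀ {x y} → ShapeDetermined x → ShapeDetermined y → ShapeDetermined (x ∘̂ y)
  ∘̂-ShapeDetermined {x} {y} (X , x≈X) (Y , y≈Y) = (λ t → convolution (sum t) (canonical t)) , x∘̂y≈
    where
    open Convolution X Y
    x∘̂y≈ : ∀ s → valid s ≡ true → (x ∘̂ y) s ≈ convolution (sum (shape s)) (canonical (shape s))
    x∘̂y≈ s v = begin
        (x ∘̂ y) s                                          ≡⟨ cong (x ∘̂ y) (sym blocks-w) ⟩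
        (x ∘̂ y) (blocks S w)                               ≈⟨ ∘̂-blocks x≈X y≈Y S S-increasing S-positive w
                                                                        (sym length-w) ⟩
        convolution (length S) w                           ≈⟨ convolution-↭ (length S) (↭-canonical-counts w) ⟩
        convolution (length S) (canonical (counts w))      ≡⟨ sym (cong₂ convolution size-s
                                                                               (cong canonical shape-s)) ⟩
        convolution (sum (shape s)) (canonical (shape s))  ∎
      where open WordOf s v

  restrict-on-support : ∀ S f {s} → support s ≡ S → restrict S f s ≡ f s
  restrict-on-support S f {s} s-supp =
    trans (cong (λ T → when (eqL T S) (f s)) s-supp) (cong (λ b → when b (f s)) (eqL-refl S))

  range-increasing : ∀ n → AllPairs _<_ (range n)
  range-increasing n = AllPairs.map⁺ (AllPairs.map s≤s (upTo-increasing n))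

  range-positive : ∀ n → All (0 <_) (range n)
  range-positive n = All.map⁺ (All.tabulate {xs = upTo n} (λ _ → s≤s z≤n))

  length-range : ∀ n → length (range n) ≡ n
  length-range n = trans (length-map suc (upTo n)) (length-upTo n)

  relabel : ∀ {n} s → valid s ≡ true → sum (shape s) ≡ n →
            Σ Symbol λ s′ → valid s′ ≡ true × support s′ ≡ range n × shape s′ ≡ shape s
  relabel {n} s v size = blocks (range n) w
                       , valid-blocks (range n) w (range-increasing n) (range-positive n) length≡ surjW-w
                       , support-blocks (range n) w (range-increasing n) length≡
                       , trans (shape-blocks (range n) w length≡) (sym shape-s)
    where
    open WordOf s v
    length≡ : length (range n) ≡ length w
    length≡ = trans (length-range n) (trans (sym size) (trans size-s length-w))

  φ-injective : ∀ {n x y} → ShapeDetermined x → ShapeDetermined y → VanishesOffSize n x → VanishesOffSize n y →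
                φ n x ≈̂ φ n y → x ≈̂ y
  φ-injective {n} {x} {y} (X , x≈X) (Y , y≈Y) x-off y-off φx≈φy s vT = by-size (sum (shape s) ℕ.≟ n)
    where
    v = to T-≡ vT
    through : (Σ Symbol λ s′ → valid s′ ≡ true × support s′ ≡ range n × shape s′ ≡ shape s) → x s ≈ y s
    through (s′ , v′ , s′-supp , same-shape) = begin
      x s                ≈⟨ x≈X s v ⟩
      X (shape s)        ≡⟨ cong X (sym same-shape) ⟩
      X (shape s′)       ≈⟨ ≈-sym (x≈X s′ v′) ⟩
      x s′               ≡⟨ sym (restrict-on-support (range n) x s′-supp) ⟩
      φ n x s′           ≈⟨ φx≈φy s′ (from T-≡ v′) ⟩
      φ n y s′           ≡⟨ restrict-on-support (range n) y s′-supp ⟩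
      y s′               ≈⟨ y≈Y s′ v′ ⟩
      Y (shape s′)       ≡⟨ cong Y same-shape ⟩
      Y (shape s)        ≈⟨ ≈-sym (y≈Y s v) ⟩
      y s                ∎
    by-size : Dec (sum (shape s) ≡ n) → x s ≈ y s
    by-size (no  off)  = ≈-trans (x-off s v off) (≈-sym (y-off s v off))
    by-size (yes size) = through (relabel s v size)

  φ-lincomb-one : ∀ {n l} → AllCompositions n l → ∀ s → φ n (lincomb one l) s ≈ lincomb O l s
  φ-lincomb-one {n} {l} l-ok s = ≈-trans (restrict-lincomb (range n) one l s) (≈-reflexive (restricted≡O l-ok))
    where
    restricted≡O : ∀ {l} → AllCompositions n l → lincomb (restrict (range n) ∘ one) l s ≡ lincomb O l s
    restricted≡O []                           = refl
    restricted≡O {(r , α) ∷ l} ((_ , Σα) ∷ l-ok) =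
      cong₂ (λ m rest → r * restrict (range m) (one α) s + rest) (sym Σα) (restricted≡O l-ok)

  InD-∘̂-closed : ∀ {n x y} → InD n x → InD n y → InD n (x ∘̂ y)
  InD-∘̂-closed {y = y} x∈D y∈D =
    ShapeDetermined⇒InD (∘̂-ShapeDetermined (InD⇒ShapeDetermined x∈D) (InD⇒ShapeDetermined y∈D))
                        (∘̂-VanishesOffSize y (InD⇒VanishesOffSize x∈D))

  φ-InD⇒InF : ∀ {n x} → InD n x → InF n (φ n x)
  φ-InD⇒InF {n} (l , l-ok , x≈) = l , l-ok , λ s v → ≈-trans (restrict-cong (range n) x≈ s v) (φ-lincomb-one l-ok s)

  InF⇒φ-image : ∀ {n z} → InF n z → Σ That λ x → InD n x × (φ n x ≈̂ z)
  InF⇒φ-image (l , l-ok , z≈) =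
    lincomb one l , (l , l-ok , λ _ _ → ≈-refl) , λ s v → ≈-trans (φ-lincomb-one l-ok s) (≈-sym (z≈ s v))

mainTheorem15 : {c ℓ : Level} (R : CommutativeRing c ℓ) → IsField R → (n : ℕ) →
    let open Construction R in
      -- (D_n, ∘) is a subalgebra of \hat T
      (∀ x y → InD n x → InD n y → InD n (x ∘̂ y))
      -- φ is a well-defined linear map D_n → F_n
      × (∀ x y → InD n x → InD n y → x ≈̂ y → φ n x ≈̂ φ n y)
      × (∀ x y → InD n x → InD n y → φ n (x +̂ y) ≈̂ (φ n x +̂ φ n y))
      × (∀ r x → InD n x → φ n (r ·̂ x) ≈̂ (r ·̂ φ n x))
      × (∀ x → InD n x → InF n (φ n x))
      -- φ is injective on D_n
      × (∀ x y → InD n x → InD n y → φ n x ≈̂ φ n y → x ≈̂ y)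
      -- φ maps D_n onto F_n
      × (∀ z → InF n z → Σ _ λ x → InD n x × (φ n x ≈̂ z))
      -- φ is multiplicative
      × (∀ x y → InD n x → InD n y → φ n (x ∘̂ y) ≈̂ (φ n x ∘̂ φ n y))
mainTheorem15 R _ n =
    (λ _ _ x∈D y∈D → InD-∘̂-closed x∈D y∈D)
  , (λ _ _ _ _ → restrict-cong (range n))
  , (λ x y _ _ s _ → restrict-+̂ (range n) x y s)
  , (λ r x _ s _ → restrict-·̂ (range n) r x s)
  , (λ _ → φ-InD⇒InF)
  , (λ _ _ x∈D y∈D → φ-injective (InD⇒ShapeDetermined x∈D) (InD⇒ShapeDetermined y∈D)
                                 (InD⇒VanishesOffSize x∈D) (InD⇒VanishesOffSize y∈D))
  , (λ _ → InF⇒φ-image)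
  , (λ x y _ _ s _ → restrict-∘̂ (range n) x y s)
  where open Algebra-T̂ R
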